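{- (i) Every graph $G$ with $\alpha(G)=2$ and $\mathrm{had}(G)<|V(G)|/2$ satisfies $\mathrm{had}(G)<\chi(G)$, and every minimal counterexample $G$ to $\mathrm{HC}_{\alpha=2}$ satisfies $\mathrm{had}(G)<|V(G)|/2$; consequently, the statement "every graph $G$ with $\alpha(G)=2$ has $\mathrm{had}(G)\ge\chi(G)$" is equivalent to the statement "every graph $G$ with $\alpha(G)=2$ has $\mathrm{had}(G)\ge|V(G)|/2$". (ii) Every graph $G$ with $\alpha(G)=2$ and $\mathrm{had}_2(G)<\lceil|V(G)|/2\rceil$ satisfies $\mathrm{had}_2(G)<\chi(G)$, and every minimal counterexample $G$ to $\mathrm{SHC}_{\alpha=2}$ satisfies $\mathrm{had}_2(G)<\lceil|V(G)|/2\rceil$; consequently, the statement "every graph $G$ with $\alpha(G)=2$ has $\mathrm{had}_2(G)\ge\chi(G)$" is equivalent to the statement "every graph $G$ with $\alpha(G)=2$ has $\mathrm{had}_2(G)\ge\lceil|V(G)|/2\rceil$". (iii) If every connected graph $G$ with $\alpha(G)=2$ has a non-empty connected dominating matching, then every graph $G$ with $\alpha(G)=2$ has $\mathrm{had}_2(G)\ge\chi(G)$; and if every graph $G$ with $\alpha(G)=2$ has $\mathrm{had}_2(G)\ge\chi(G)$, then every graph $G$ with $\alpha(G)=2$ has $\mathrm{had}(G)\ge\chi(G)$.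
   Context: All graphs are finite and simple. $\mathrm{had}(G)$ is the largest $t$ such that $K_t$ is a minor of $G$; $\mathrm{had}_2(G)$ is the largest $t$ such that $G$ has a model of $K_t$ (pairwise disjoint vertex sets, each inducing a connected subgraph, with an edge between every two of them) in which every branch set has one or two vertices. A counterexample to $\mathrm{HC}_{\alpha=2}$ is a graph $G$ with $\alpha(G)=2$ and $\mathrm{had}(G)<\chi(G)$; a counterexample to $\mathrm{SHC}_{\alpha=2}$ is a graph with $\alpha(G)=2$ and $\mathrm{had}_2(G)<\chi(G)$; a minimal counterexample is a counterexample none of whose proper induced subgraphs is a counterexample. A matching $M$ is connected if for any two edges $e,f\in M$ some endpoint of $e$ is adjacent to some endpoint of $f$; it is dominating if every vertex not covered by $M$ is adjacent to at least one endpoint of each edge of $M$. -}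

module Defs where

open import Data.Nat using (ℕ; zero; suc; _+_; _*_; _≤_; _<_; ⌈_/2⌉)
open import Data.Fin using (Fin)
open import Data.Bool using (Bool)
open import Data.Maybe using (Maybe; just)
open import Data.Product using (Σ; ∃; _×_; _,_)
open import Data.Sum using (_⊎_)
open import Data.Empty using (⊥)
open import Relation.Nullary using (¬_; Dec)
open import Relation.Binary.PropositionalEquality using (_≡_; _≢_)
open import Function.Definitions using (Injective)
open import Function.Bundles using (_⇔_)

record Graph : Set₁ where
  field
    n      : ℕ
    _~_    : Fin n → Fin n → Set
    ~-sym  : ∀ {u v} → u ~ v → v ~ u
    ~-irr  : ∀ {v} → ¬ (v ~ v)
    ~-dec  : ∀ u v → Dec (u ~ v)

open Graph public

∣V∣ : Graph → ℕ
∣V∣ G = n G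

induced : (G : Graph) {m : ℕ} (f : Fin m → Fin (n G)) → Graph
induced G {m} f = record
  { n     = m
  ; _~_   = λ u v → _~_ G (f u) (f v)
  ; ~-sym = ~-sym G
  ; ~-irr = ~-irr G
  ; ~-dec = λ u v → ~-dec G (f u) (f v)
  }

-- "H is a proper induced subgraph of G" is expressed by quantifying over
-- m < n G and injective f, with H = induced G f.

IndependentSetOfSize : Graph → ℕ → Set
IndependentSetOfSize G k =
  Σ (Fin k → Fin (n G)) λ f →
    Injective _≡_ _≡_ f × (∀ i j → ¬ (_~_ G (f i) (f j)))

IsAlpha : Graph → ℕ → Set
IsAlpha G a = IndependentSetOfSize G a × (∀ k → IndependentSetOfSize G k → k ≤ a)

Colorable : Graph → ℕ → Set
Colorable G k =
  Σ (Fin (n G) → Fin k) λ c → ∀ u v → _~_ G u v → c u ≢ c v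

IsChi : Graph → ℕ → Set
IsChi G c = Colorable G c × (∀ k → Colorable G k → c ≤ k)

data WalkIn (G : Graph) (P : Fin (n G) → Set) : Fin (n G) → Fin (n G) → Set where
  here : ∀ {u} → P u → WalkIn G P u u
  step : ∀ {u v w} → P u → _~_ G u v → WalkIn G P v w → WalkIn G P u w

ConnectedIn : (G : Graph) → (Fin (n G) → Set) → Set
ConnectedIn G P = ∀ u v → P u → P v → WalkIn G P u v

Connected : Graph → Set
Connected G = ∀ u v → WalkIn G (λ _ → Fin (n G)) u v

-- Models of K_t.  A model is given by β : V(G) → Maybe (Fin t), where
-- β v = just i means v lies in branch set i (so branch sets are pairwise
-- disjoint automatically).

record KModel (G : Graph) (t : ℕ) : Set where
  field
    β         : Fin (n G) → Maybe (Fin t)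
    nonempty  : ∀ i → ∃ λ v → β v ≡ just i
    connected : ∀ i → ConnectedIn G (λ v → β v ≡ just i)
    adjacent  : ∀ i j → i ≢ j →
                ∃ λ u → ∃ λ v → β u ≡ just i × β v ≡ just j × _~_ G u v

SmallBranchSets : {G : Graph} {t : ℕ} → KModel G t → Set
SmallBranchSets {G} {t} M = ∀ (i : Fin t) (u v w : Fin (n G)) →
  KModel.β M u ≡ just i → KModel.β M v ≡ just i → KModel.β M w ≡ just i →
  (u ≡ v) ⊎ (u ≡ w) ⊎ (v ≡ w)

HasCliqueMinor : Graph → ℕ → Set
HasCliqueMinor G t = KModel G t

HasCliqueMinor₂ : Graph → ℕ → Set
HasCliqueMinor₂ G t = Σ (KModel G t) SmallBranchSets

IsHad : Graph → ℕ → Set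
IsHad G h = HasCliqueMinor G h × (∀ t → HasCliqueMinor G t → t ≤ h)

IsHad₂ : Graph → ℕ → Set
IsHad₂ G h = HasCliqueMinor₂ G h × (∀ t → HasCliqueMinor₂ G t → t ≤ h)

-- Comparisons involving had, had₂, χ (these numbers always exist for
-- finite graphs; we quantify over the unique values).

had<χ : Graph → Set
had<χ G = ∀ h c → IsHad G h → IsChi G c → h < c

had₂<χ : Graph → Set
had₂<χ G = ∀ h c → IsHad₂ G h → IsChi G c → h < c

had<half : Graph → Set
had<half G = ∀ h → IsHad G h → 2 * h < ∣V∣ G

had₂<ceilHalf : Graph → Set
had₂<ceilHalf G = ∀ h → IsHad₂ G h → h < ⌈ ∣V∣ G /2⌉

CounterHC : Graph → Set
CounterHC G = IsAlpha G 2 × had<χ G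

CounterSHC : Graph → Set
CounterSHC G = IsAlpha G 2 × had₂<χ G

Minimal : (Graph → Set) → Graph → Set
Minimal C G = C G × (∀ m (f : Fin m → Fin (n G)) → m < n G →
                      Injective _≡_ _≡_ f → ¬ C (induced G f))

HC-α2 : Set₁
HC-α2 = ∀ G → IsAlpha G 2 → ∀ h c → IsHad G h → IsChi G c → c ≤ h

SHC-α2 : Set₁
SHC-α2 = ∀ G → IsAlpha G 2 → ∀ h c → IsHad₂ G h → IsChi G c → c ≤ h

HalfHC-α2 : Set₁
HalfHC-α2 = ∀ G → IsAlpha G 2 → ∀ h → IsHad G h → ∣V∣ G ≤ 2 * h

HalfSHC-α2 : Set₁
HalfSHC-α2 = ∀ G → IsAlpha G 2 → ∀ h → IsHad₂ G h → ⌈ ∣V∣ G /2⌉ ≤ h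

record Matching (G : Graph) : Set where
  field
    m      : ℕ
    a b    : Fin m → Fin (n G)
    edge   : ∀ i → _~_ G (a i) (b i)
    ab-dis : ∀ i j → a i ≢ b j
    a-inj  : Injective _≡_ _≡_ a
    b-inj  : Injective _≡_ _≡_ b

  Endpoint : Fin m → Fin (n G) → Set
  Endpoint i v = (v ≡ a i) ⊎ (v ≡ b i)

  Covered : Fin (n G) → Set
  Covered v = ∃ λ i → Endpoint i v

open Matching public using (Endpoint; Covered)

NonEmptyMatching : {G : Graph} → Matching G → Set
NonEmptyMatching M = 1 ≤ Matching.m M

ConnectedMatching : {G : Graph} → Matching G → Set
ConnectedMatching {G} M = ∀ i j → ∃ λ x → ∃ λ y →
  Endpoint M i x × Endpoint M j y × _~_ G x y

DominatingMatching : {G : Graph} → Matching G → Set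
DominatingMatching {G} M = ∀ v → ¬ Covered M v → ∀ i → ∃ λ x →
  Endpoint M i x × _~_ G v x

HasNonEmptyConnDomMatching : Graph → Set
HasNonEmptyConnDomMatching G = Σ (Matching G) λ M →
  NonEmptyMatching M × ConnectedMatching M × DominatingMatching M

{-# OPTIONS --safe #-}
-- If α(G) ≤ 2, every color class has at most two vertices, so colorings of G are matchings of the
-- complement Ḡ and 2χ(G) = n + def(Ḡ), the number of vertices plus the number left unmatched by a
-- maximum matching; in particular n ≤ 2χ. In a minimal counterexample G, each G − v is colored with
-- at most had(G) < χ(G) colors, so every vertex of Ḡ is missed by some maximum matching, and Ḡ is
-- connected, since otherwise G is the join of two smaller graphs whose models and colorings add up.
-- Gallai's lemma then makes Ḡ factor-critical, so 2χ ≤ n + 1 (Plummer–Stiebitz–Toft), and the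
-- equivalences follow by induction on n. For (iii), a connected dominating matching with m edges is a
-- K_m model with branch sets of size two that extends any such model of the graph on the uncovered
-- vertices, so induction gives had₂ ≥ ⌈n/2⌉. All comparisons of extremal numbers are decidable, which
-- lets the classical steps run in the double-negation monad.
module Submission where

open import Algebra.Properties.Semiring.Sum as Summation using ()
open import Data.Bool using (Bool; true; false; not; if_then_else_)
open import Data.Empty using (⊥; ⊥-elim)
open import Data.Fin using (Fin; zero; suc; toℕ; fromℕ; fromℕ<; inject₁; inject≤; splitAt; _↑ˡ_; _↑ʳ_)
  renaming (join to join⊎)
import Data.Fin.Properties as Fin
open import Data.Fin.Permutation using (Permutation′; permutation)
open import Data.Fin.Properties
  using (_≟_; suc-injective; any?; all?; ¬∀⟶∃¬; injective⇒≤; toℕ-fromℕ<; splitAt-join;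
         fromℕ≢inject₁; inject₁-injective; inject≤-injective; ↑ˡ-injective; ↑ʳ-injective)
open import Data.Nat using (ℕ; zero; suc; _+_; _*_; _∸_; _≤_; _<_; z≤n; s≤s; s≤s⁻¹; _≤?_; _<?_; ⌊_/2⌋; ⌈_/2⌉)
open import Data.Nat.Induction using (<-rec)
open import Data.Nat.Properties hiding (_≟_; suc-injective)
open import Data.Product using (Σ; ∃; _×_; _,_; proj₁; proj₂)
open import Data.Maybe using (Maybe; just; nothing; maybe; fromMaybe; is-nothing)
open import Data.Maybe.Properties using (just-injective)
open import Data.Sum as Sum using (_⊎_; inj₁; inj₂)
open import Effect.Monad using (RawMonad)
open import Function using (_∘_; case_of_)
open import Function.Bundles using (_⇔_; mk⇔)
open import Function.Definitions using (Injective)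
open import Level using (0ℓ)
open import Relation.Nullary using (¬_; Dec; yes; no; does)
open import Relation.Nullary.Decidable
  using (dec-true; dec-false; decidable-stable; ¬¬-excluded-middle; ¬?; _×-dec_; _⊎-dec_)
open import Relation.Nullary.Negation using (DoubleNegation; ¬¬-Monad)
open import Relation.Unary using (Decidable)
open import Relation.Binary.Construct.Closure.ReflexiveTransitive using (Star; ε; _◅_; _◅◅_)
open import Relation.Binary.Definitions using (tri<; tri≈; tri>)
open import Relation.Binary.PropositionalEquality

open import Defs

open Summation +-*-semiring using (sum; sum-permute; ∑-distrib-+; sum-cong-≗; sum-replicate-zero)
open RawMonad (¬¬-Monad {0ℓ}) using (_>>=_; _<$>_; return)

¬¬-∀-Fin : ∀ {n} {P : Fin n → Set} → (∀ i → DoubleNegation (P i)) → DoubleNegation (∀ i → P i)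
¬¬-∀-Fin {zero}  _   = return λ ()
¬¬-∀-Fin {suc n} ¬¬P = do
  p₀ ← ¬¬P zero
  ps ← ¬¬-∀-Fin (¬¬P ∘ suc)
  return λ { zero → p₀ ; (suc i) → ps i }

¬¬-decidable : ∀ {n} (P : Fin n → Set) → DoubleNegation (Decidable P)
¬¬-decidable P = ¬¬-∀-Fin λ _ → ¬¬-excluded-middle

¬¬-least : (P : ℕ → Set) {k : ℕ} → P k → DoubleNegation (∃ λ m → P m × ∀ j → P j → m ≤ j)
¬¬-least P {k} pk noLeast = <-rec (λ j → ¬ P j) notP k pk
  where
  notP : ∀ j → (∀ {i} → i < j → ¬ P i) → ¬ P j
  notP j below pj = noLeast (j , pj , λ i pi → ≮⇒≥ λ i<j → below i<j pi)

¬¬-greatest : (P : ℕ → Set) {k B : ℕ} → P k → (∀ j → P j → j ≤ B) →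
              DoubleNegation (∃ λ m → P m × ∀ j → P j → j ≤ m)
¬¬-greatest P {k} {B} pk bounded noGreatest = climb (suc B) k pk (m≤n+m (suc B) k)
  where
  larger : ∀ j → P j → DoubleNegation (∃ λ i → P i × j < i)
  larger j pj none = noGreatest (j , pj , λ i pi → ≮⇒≥ λ j<i → none (i , pi , j<i))
  climb : ∀ d j → P j → B < j + d → ⊥
  climb zero    j pj B<j   = <⇒≱ (subst (B <_) (+-identityʳ j) B<j) (bounded j pj)
  climb (suc d) j pj B<j+d = larger j pj λ (i , pi , j<i) →
    climb d i pi (≤-trans B<j+d (subst (_≤ i + d) (sym (+-suc j d)) (+-monoˡ-≤ d j<i)))

sum-const : ∀ n k → sum {n} (λ _ → k) ≡ n * k
sum-const zero    k = refl
sum-const (suc n) k = cong (k +_) (sum-const n k)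

sum-mono : ∀ {n} {f g : Fin n → ℕ} → (∀ x → f x ≤ g x) → sum f ≤ sum g
sum-mono {zero}  f≤g = z≤n
sum-mono {suc n} f≤g = +-mono-≤ (f≤g zero) (sum-mono (f≤g ∘ suc))

sum-single : ∀ {n} (a : Fin n) (f : Fin n → ℕ) → sum (λ x → if does (a ≟ x) then f x else 0) ≡ f a
sum-single {suc n} zero    f = trans (cong (f zero +_) (sum-replicate-zero n)) (+-identityʳ (f zero))
sum-single {suc n} (suc a) f = sum-single a (f ∘ suc)

term≤sum : ∀ {n} (a : Fin n) (f : Fin n → ℕ) → f a ≤ sum f
term≤sum a f = subst (_≤ sum f) (sum-single a f) (sum-mono restrict≤)
  where
  restrict≤ : ∀ x → (if does (a ≟ x) then f x else 0) ≤ f x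
  restrict≤ x with a ≟ x
  ... | yes _ = ≤-refl
  ... | no _  = z≤n

indicator : Bool → ℕ
indicator b = if b then 1 else 0

indicators≡1 : ∀ {a b} → indicator a + indicator b ≡ 1 → a ≡ false → b ≡ true
indicators≡1 {false} {true} _ _ = refl

not≡true⇒≡false : ∀ {b} → not b ≡ true → b ≡ false
not≡true⇒≡false {false} _ = refl

same-or-other : ∀ b c → b ≡ c ⊎ b ≡ not c
same-or-other false false = inj₁ refl
same-or-other false true  = inj₂ refl
same-or-other true  false = inj₂ refl
same-or-other true  true  = inj₁ refl

count : ∀ {n} → (Fin n → Bool) → ℕ
count p = sum (indicator ∘ p)

count-complement : ∀ {n} (p : Fin n → Bool) → count p + count (not ∘ p) ≡ n
count-complement {n} p = begin
  count p + count (not ∘ p)                           ≡⟨ ∑-distrib-+ (indicator ∘ p) (indicator ∘ not ∘ p) ⟨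
  sum (λ x → indicator (p x) + indicator (not (p x))) ≡⟨ sum-cong-≗ exactlyOne ⟩
  sum {n} (λ _ → 1)                                   ≡⟨ sum-const n 1 ⟩
  n * 1                                               ≡⟨ *-identityʳ n ⟩
  n                                                   ∎
  where
  open ≡-Reasoning
  exactlyOne : ∀ x → indicator (p x) + indicator (not (p x)) ≡ 1
  exactlyOne x with p x
  ... | true  = refl
  ... | false = refl

count< : ∀ {n} (p : Fin n → Bool) {x} → p x ≡ false → count p < n
count< {n} p {x} px = begin-strict
  count p                    <⟨ m<m+n (count p) someOutside ⟩
  count p + count (not ∘ p)  ≡⟨ count-complement p ⟩
  n                          ∎
  where
  open ≤-Reasoning
  someOutside : 0 < count (not ∘ p)
  someOutside = subst (λ b → indicator (not b) ≤ count (not ∘ p)) px (term≤sum x (indicator ∘ not ∘ p))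

record Enumeration {n} (p : Fin n → Bool) : Set where
  field
    size              : ℕ
    size≡count        : size ≡ count p
    element           : Fin size → Fin n
    element-injective : Injective _≡_ _≡_ element
    element-∈         : ∀ i → p (element i) ≡ true
    index             : ∀ x → p x ≡ true → Fin size
    element-index     : ∀ x px → element (index x px) ≡ x

  size< : ∀ {x} → p x ≡ false → size < n
  size< px = subst (_< n) (sym size≡count) (count< p px)

  two-elements : 2 ≤ size → ∃ λ x → ∃ λ y → x ≢ y × p x ≡ true × p y ≡ true
  two-elements 2≤size =
    element first , element second , first≢second ∘ element-injective , element-∈ first , element-∈ second
    where
    first second : Fin size
    first  = fromℕ< (≤-trans (s≤s z≤n) 2≤size)
    second = fromℕ< 2≤size
    first≢second : first ≢ second
    first≢second e = case trans (sym (toℕ-fromℕ< _)) (trans (cong toℕ e) (toℕ-fromℕ< _)) of λ ()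

enumerate : ∀ {n} (p : Fin n → Bool) → Enumeration p
enumerate {zero} p = record
  { size = 0 ; size≡count = refl ; element = λ () ; element-injective = λ {} ; element-∈ = λ ()
  ; index = λ () ; element-index = λ () }
enumerate {suc n} p with p zero in p₀ | enumerate (p ∘ suc)
... | true  | E = record
  { size              = suc size
  ; size≡count        = trans (cong suc size≡count) (cong (λ b → indicator b + count (p ∘ suc)) (sym p₀))
  ; element           = λ { zero → zero ; (suc i) → suc (element i) }
  ; element-injective = λ { {zero} {zero} _ → refl
                          ; {suc i} {suc j} e → cong suc (element-injective (suc-injective e)) }
  ; element-∈         = λ { zero → p₀ ; (suc i) → element-∈ i }
  ; index             = λ { zero _ → zero ; (suc x) px → suc (index x px) }
  ; element-index     = λ { zero _ → refl ; (suc x) px → cong suc (element-index x px) }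
  }
  where open Enumeration E
... | false | E = record
  { size              = size
  ; size≡count        = trans size≡count (cong (λ b → indicator b + count (p ∘ suc)) (sym p₀))
  ; element           = suc ∘ element
  ; element-injective = element-injective ∘ suc-injective
  ; element-∈         = element-∈
  ; index             = λ { zero px → case trans (sym p₀) px of λ () ; (suc x) px → index x px }
  ; element-index     = λ { zero px → case trans (sym p₀) px of λ ()
                          ; (suc x) px → cong suc (element-index x px) }
  }
  where open Enumeration E

NonEdge : (G : Graph) → Fin (n G) → Fin (n G) → Set
NonEdge G x y = x ≢ y × ¬ _~_ G x y

NonEdge-sym : ∀ G {x y} → NonEdge G x y → NonEdge G y x
NonEdge-sym G (x≢y , x≁y) = x≢y ∘ sym , x≁y ∘ ~-sym G

Complete : Graph → Set
Complete G = ∀ x y → x ≢ y → _~_ G x y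

NoIndependentTriple : Graph → Set
NoIndependentTriple G = ¬ IndependentSetOfSize G 3

α≡2⇒noIndependentTriple : ∀ G → IsAlpha G 2 → NoIndependentTriple G
α≡2⇒noIndependentTriple G (_ , maximal) I with maximal 3 I
... | s≤s (s≤s ())

noIndependentTriple-induced : ∀ G {m} {f : Fin m → Fin (n G)} → Injective _≡_ _≡_ f →
                              NoIndependentTriple G → NoIndependentTriple (induced G f)
noIndependentTriple-induced G {f = f} f-inj noTriple (g , g-inj , g-indep) =
  noTriple (f ∘ g , g-inj ∘ f-inj , g-indep)

independentSet : ∀ G {k} (f : Fin k → Fin (n G)) → (∀ i j → i ≢ j → NonEdge G (f i) (f j)) →
                 IndependentSetOfSize G k
independentSet G f apart = f , injective , independent
  where
  injective : Injective _≡_ _≡_ f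
  injective {i} {j} fi≡fj with i ≟ j
  ... | yes i≡j = i≡j
  ... | no  i≢j = ⊥-elim (proj₁ (apart i j i≢j) fi≡fj)
  independent : ∀ i j → ¬ _~_ G (f i) (f j)
  independent i j with i ≟ j
  ... | yes refl = ~-irr G
  ... | no  i≢j  = proj₂ (apart i j i≢j)

independentTriple : ∀ G {x y z} → NonEdge G x y → NonEdge G x z → NonEdge G y z →
                    IndependentSetOfSize G 3
independentTriple G {x} {y} {z} xy xz yz = independentSet G triple apart
  where
  triple : Fin 3 → Fin (n G)
  triple zero          = x
  triple (suc zero)    = y
  triple (suc (suc _)) = z
  apart : ∀ i j → i ≢ j → NonEdge G (triple i) (triple j)
  apart zero                zero                i≢i = ⊥-elim (i≢i refl)
  apart zero                (suc zero)          _   = xy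
  apart zero                (suc (suc zero))    _   = xz
  apart (suc zero)          zero                _   = NonEdge-sym G xy
  apart (suc zero)          (suc zero)          i≢i = ⊥-elim (i≢i refl)
  apart (suc zero)          (suc (suc zero))    _   = yz
  apart (suc (suc zero))    zero                _   = NonEdge-sym G xz
  apart (suc (suc zero))    (suc zero)          _   = NonEdge-sym G yz
  apart (suc (suc zero))    (suc (suc zero))    i≢i = ⊥-elim (i≢i refl)

α≡2 : ∀ G {x y} → NoIndependentTriple G → NonEdge G x y → IsAlpha G 2
α≡2 G {x} {y} noTriple xy = independentSet G pair apart , atMostTwo
  where
  pair : Fin 2 → Fin (n G)
  pair zero    = x
  pair (suc _) = y
  apart : ∀ i j → i ≢ j → NonEdge G (pair i) (pair j)
  apart zero       zero       i≢i = ⊥-elim (i≢i refl)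
  apart zero       (suc zero) _   = xy
  apart (suc zero) zero       _   = NonEdge-sym G xy
  apart (suc zero) (suc zero) i≢i = ⊥-elim (i≢i refl)
  atMostTwo : ∀ k → IndependentSetOfSize G k → k ≤ 2
  atMostTwo k (f , f-inj , f-indep) with k ≤? 2
  ... | yes k≤2 = k≤2
  ... | no  k≰2 =
    ⊥-elim (noTriple (f ∘ first3 , inject≤-injective _ _ _ _ ∘ f-inj , λ i j → f-indep (first3 i) (first3 j)))
    where
    first3 : Fin 3 → Fin k
    first3 i = inject≤ i (≰⇒> k≰2)

nonEdgeOrComplete : ∀ G → (∃ λ x → ∃ λ y → NonEdge G x y) ⊎ Complete G
nonEdgeOrComplete G with any? (λ x → any? (λ y → ¬? (x ≟ y) ×-dec ¬? (~-dec G x y)))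
... | yes (x , y , xy) = inj₁ (x , y , xy)
... | no  noNonEdge    = inj₂ λ x y x≢y → decidable-stable (~-dec G x y) λ x≁y → noNonEdge (x , y , x≢y , x≁y)

Colorable-weaken : ∀ G {k k′} → Colorable G k → k ≤ k′ → Colorable G k′
Colorable-weaken G (c , proper) k≤k′ =
  (λ x → inject≤ (c x) k≤k′) , λ u v u~v → proper u v u~v ∘ inject≤-injective _ _ _ _

Colorable-trivial : ∀ G → Colorable G (n G)
Colorable-trivial G = (λ x → x) , λ u v u~v u≡v → ~-irr G (subst (_~_ G u) (sym u≡v) u~v)

¬¬-χ : ∀ G → DoubleNegation (∃ (IsChi G))
¬¬-χ G = ¬¬-least (Colorable G) (Colorable-trivial G)

IsChi-unique : ∀ G {c c′} → IsChi G c → IsChi G c′ → c ≡ c′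
IsChi-unique G (col , least) (col′ , least′) = ≤-antisym (least _ col′) (least′ _ col)

-- Clique models

WalkIn-mono : ∀ G {P Q : Fin (n G) → Set} → (∀ {w} → P w → Q w) → ∀ {u v} → WalkIn G P u v → WalkIn G Q u v
WalkIn-mono G P⇒Q (here pu)       = here (P⇒Q pu)
WalkIn-mono G P⇒Q (step pu u~v w) = step (P⇒Q pu) u~v (WalkIn-mono G P⇒Q w)

WalkIn-induced : ∀ G {m} (g : Fin m → Fin (n G)) {P : Fin m → Set} {Q : Fin (n G) → Set} →
                 (∀ {w} → P w → Q (g w)) → ∀ {u v} → WalkIn (induced G g) P u v → WalkIn G Q (g u) (g v)
WalkIn-induced G g P⇒Q (here pu)       = here (P⇒Q pu)
WalkIn-induced G g P⇒Q (step pu u~v w) = step (P⇒Q pu) u~v (WalkIn-induced G g P⇒Q w)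

WalkIn-snoc : ∀ G {P : Fin (n G) → Set} {u x y} → WalkIn G P u x → _~_ G x y → P y → WalkIn G P u y
WalkIn-snoc G (here px)       x~y py = step px x~y (here py)
WalkIn-snoc G (step pu u~v w) x~y py = step pu u~v (WalkIn-snoc G w x~y py)

open KModel

model-size≤ : ∀ G {t} → KModel G t → t ≤ n G
model-size≤ G {t} M = injective⇒≤ {f = representative} representative-injective
  where
  representative : Fin t → Fin (n G)
  representative i = proj₁ (nonempty M i)
  representative-injective : Injective _≡_ _≡_ representative
  representative-injective {i} {j} e = just-injective (begin
    just i                      ≡⟨ proj₂ (nonempty M i) ⟨
    β M (representative i)      ≡⟨ cong (β M) e ⟩
    β M (representative j)      ≡⟨ proj₂ (nonempty M j) ⟩
    just j                      ∎)
    where open ≡-Reasoning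

emptyModel : ∀ G → HasCliqueMinor₂ G 0
emptyModel G = record { β = λ _ → nothing ; nonempty = λ () ; connected = λ () ; adjacent = λ () } , λ ()

completeModel : ∀ G → Complete G → HasCliqueMinor₂ G (n G)
completeModel G complete = M , small
  where
  M : KModel G (n G)
  M = record
    { β         = just
    ; nonempty  = λ i → i , refl
    ; connected = λ { i u v refl refl → here refl }
    ; adjacent  = λ i j i≢j → i , j , refl , refl , complete i j i≢j
    }
  small : SmallBranchSets M
  small i u v w refl refl _ = inj₁ refl

module Lift (G : Graph) {m} {g : Fin m → Fin (n G)} (g-injective : Injective _≡_ _≡_ g) where

  preimage : Fin (n G) → Maybe (Fin m)
  preimage x with any? (λ i → g i ≟ x)
  ... | yes (i , _) = just i
  ... | no _        = nothing

  preimage-image : ∀ i → preimage (g i) ≡ just i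
  preimage-image i with any? (λ j → g j ≟ g i)
  ... | yes (j , gj≡gi) = cong just (g-injective gj≡gi)
  ... | no  none        = ⊥-elim (none (i , refl))

  pullback : ∀ {t} → (Fin m → Maybe (Fin t)) → Fin (n G) → Maybe (Fin t)
  pullback β′ x = maybe β′ nothing (preimage x)

  pullback-image : ∀ {t} (β′ : Fin m → Maybe (Fin t)) i → pullback β′ (g i) ≡ β′ i
  pullback-image β′ i = cong (maybe β′ nothing) (preimage-image i)

  pullback-just : ∀ {t} (β′ : Fin m → Maybe (Fin t)) x {k} → pullback β′ x ≡ just k →
                  ∃ λ i → g i ≡ x × β′ i ≡ just k
  pullback-just β′ x e with any? (λ i → g i ≟ x)
  ... | yes (i , gi≡x) = i , gi≡x , e

  lift : ∀ {t} → KModel (induced G g) t → KModel G t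
  lift M = record
    { β         = pullback (β M)
    ; nonempty  = λ i → let (v , βv) = nonempty M i in g v , trans (pullback-image (β M) v) βv
    ; connected = connected′
    ; adjacent  = λ i j i≢j → let (u , v , βu , βv , u~v) = adjacent M i j i≢j in
                    g u , g v , trans (pullback-image (β M) u) βu , trans (pullback-image (β M) v) βv , u~v
    }
    where
    connected′ : ∀ i → ConnectedIn G (λ v → pullback (β M) v ≡ just i)
    connected′ i u v βu βv with pullback-just (β M) u βu | pullback-just (β M) v βv
    ... | (u′ , refl , βu′) | (v′ , refl , βv′) =
      WalkIn-induced G g (λ {w} βw → trans (pullback-image (β M) w) βw) (connected M i u′ v′ βu′ βv′)

  lift-small : ∀ {t} (M : KModel (induced G g) t) → SmallBranchSets M → SmallBranchSets (lift M)
  lift-small M small i u v w βu βv βw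
    with pullback-just (β M) u βu | pullback-just (β M) v βv | pullback-just (β M) w βw
  ... | (u′ , refl , βu′) | (v′ , refl , βv′) | (w′ , refl , βw′) =
    Sum.map (cong g) (Sum.map (cong g) (cong g)) (small i u′ v′ w′ βu′ βv′ βw′)

  lift₂ : ∀ {t} → HasCliqueMinor₂ (induced G g) t → HasCliqueMinor₂ G t
  lift₂ (M , small) = lift M , lift-small M small

cliqueModel : ∀ G (p : Fin (n G) → Bool) → (∀ x y → p x ≡ true → p y ≡ true → x ≢ y → _~_ G x y) →
              HasCliqueMinor₂ G (count p)
cliqueModel G p clique = subst (HasCliqueMinor₂ G) P.size≡count
  (Lift.lift₂ G P.element-injective (completeModel (induced G P.element)
    λ i j i≢j → clique _ _ (P.element-∈ i) (P.element-∈ j) (i≢j ∘ P.element-injective)))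
  where module P = Enumeration (enumerate p)

data Split (t₁ t₂ : ℕ) : Fin (t₁ + t₂) → Set where
  left  : ∀ i → Split t₁ t₂ (i ↑ˡ t₂)
  right : ∀ j → Split t₁ t₂ (t₁ ↑ʳ j)

split : ∀ t₁ t₂ k → Split t₁ t₂ k
split zero     t₂ k       = right k
split (suc t₁) t₂ zero    = left zero
split (suc t₁) t₂ (suc k) with split t₁ t₂ k
... | left i  = left (suc i)
... | right j = right j

↑ˡ≢↑ʳ : ∀ {t₁ t₂} (i : Fin t₁) (j : Fin t₂) → i ↑ˡ t₂ ≢ t₁ ↑ʳ j
↑ˡ≢↑ʳ {suc t₁} zero    j ()
↑ˡ≢↑ʳ {suc t₁} (suc i) j e = ↑ˡ≢↑ʳ i j (suc-injective e)

module Combine (G : Graph) {t₁ t₂} (M₁ : KModel G t₁) (M₂ : KModel G t₂)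
  (disjoint : ∀ x {i} → β M₁ x ≡ just i → β M₂ x ≡ nothing)
  (touching : ∀ i j → ∃ λ u → ∃ λ v → β M₁ u ≡ just i × β M₂ v ≡ just j × _~_ G u v) where

  β₁₂ : Fin (n G) → Maybe (Fin (t₁ + t₂))
  β₁₂ x with β M₁ x | β M₂ x
  ... | just i  | _       = just (i ↑ˡ t₂)
  ... | nothing | just j  = just (t₁ ↑ʳ j)
  ... | nothing | nothing = nothing

  β-left : ∀ {x i} → β M₁ x ≡ just i → β₁₂ x ≡ just (i ↑ˡ t₂)
  β-left {x} βx with β M₁ x
  β-left refl | just i = refl

  β-right : ∀ {x j} → β M₂ x ≡ just j → β₁₂ x ≡ just (t₁ ↑ʳ j)
  β-right {x} βx with β M₁ x in β₁x
  ... | just i  = case trans (sym βx) (disjoint x β₁x) of λ ()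
  ... | nothing with β M₂ x
  β-right refl | nothing | just j = refl

  β-left⁻¹ : ∀ {x i} → β₁₂ x ≡ just (i ↑ˡ t₂) → β M₁ x ≡ just i
  β-left⁻¹ {x} {i} e with β M₁ x | β M₂ x
  ... | just i′ | _       = cong just (↑ˡ-injective t₂ i′ i (just-injective e))
  ... | nothing | just j  = ⊥-elim (↑ˡ≢↑ʳ i j (sym (just-injective e)))

  β-right⁻¹ : ∀ {x j} → β₁₂ x ≡ just (t₁ ↑ʳ j) → β M₂ x ≡ just j
  β-right⁻¹ {x} {j} e with β M₁ x | β M₂ x
  ... | just i  | _       = ⊥-elim (↑ˡ≢↑ʳ i j (just-injective e))
  ... | nothing | just j′ = cong just (↑ʳ-injective t₁ j′ j (just-injective e))

  combined : KModel G (t₁ + t₂)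
  combined = record { β = β₁₂ ; nonempty = nonempty′ ; connected = connected′ ; adjacent = adjacent′ }
    where
    nonempty′ : ∀ k → ∃ λ v → β₁₂ v ≡ just k
    nonempty′ k with split t₁ t₂ k
    ... | left i  = let (v , βv) = nonempty M₁ i in v , β-left βv
    ... | right j = let (v , βv) = nonempty M₂ j in v , β-right βv
    connected′ : ∀ k → ConnectedIn G (λ v → β₁₂ v ≡ just k)
    connected′ k u v βu βv with split t₁ t₂ k
    ... | left i  = WalkIn-mono G β-left (connected M₁ i u v (β-left⁻¹ βu) (β-left⁻¹ βv))
    ... | right j = WalkIn-mono G β-right (connected M₂ j u v (β-right⁻¹ βu) (β-right⁻¹ βv))
    adjacent′ : ∀ k l → k ≢ l → ∃ λ u → ∃ λ v → β₁₂ u ≡ just k × β₁₂ v ≡ just l × _~_ G u v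
    adjacent′ k l k≢l with split t₁ t₂ k | split t₁ t₂ l
    ... | left i  | left i′  = let (u , v , βu , βv , u~v) = adjacent M₁ i i′ (k≢l ∘ cong (_↑ˡ t₂)) in
                                 u , v , β-left βu , β-left βv , u~v
    ... | right j | right j′ = let (u , v , βu , βv , u~v) = adjacent M₂ j j′ (k≢l ∘ cong (t₁ ↑ʳ_)) in
                                 u , v , β-right βu , β-right βv , u~v
    ... | left i  | right j  = let (u , v , βu , βv , u~v) = touching i j in
                                 u , v , β-left βu , β-right βv , u~v
    ... | right j | left i   = let (u , v , βu , βv , u~v) = touching i j in
                                 v , u , β-right βv , β-left βu , ~-sym G u~v

  combined-small : SmallBranchSets M₁ → SmallBranchSets M₂ → SmallBranchSets combined
  combined-small small₁ small₂ k u v w βu βv βw with split t₁ t₂ k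
  ... | left i  = small₁ i u v w (β-left⁻¹ βu) (β-left⁻¹ βv) (β-left⁻¹ βw)
  ... | right j = small₂ j u v w (β-right⁻¹ βu) (β-right⁻¹ βv) (β-right⁻¹ βw)

module Join (G : Graph) (p : Fin (n G) → Bool)
  (complete : ∀ x y → p x ≡ true → p y ≡ false → _~_ G x y) where

  module Inside  = Enumeration (enumerate p)
  module Outside = Enumeration (enumerate (not ∘ p))

  Inside-graph Outside-graph : Graph
  Inside-graph  = induced G Inside.element
  Outside-graph = induced G Outside.element

  private
    module L₁ = Lift G Inside.element-injective
    module L₂ = Lift G Outside.element-injective

    outside : ∀ j → p (Outside.element j) ≡ false
    outside j = not≡true⇒≡false (Outside.element-∈ j)

    module _ {t₁ t₂} (M₁ : KModel Inside-graph t₁) (M₂ : KModel Outside-graph t₂) where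
      disjoint : ∀ x {i} → L₁.pullback (β M₁) x ≡ just i → L₂.pullback (β M₂) x ≡ nothing
      disjoint x β₁x with L₁.pullback-just (β M₁) x β₁x
      ... | (a , refl , _) with L₂.pullback (β M₂) (Inside.element a) in β₂x
      ... | nothing = refl
      ... | just j with L₂.pullback-just (β M₂) (Inside.element a) β₂x
      ... | (b , b≡a , _) = case trans (sym (Inside.element-∈ a)) (trans (cong p (sym b≡a)) (outside b)) of λ ()

      touching : ∀ i j → ∃ λ u → ∃ λ v → L₁.pullback (β M₁) u ≡ just i × L₂.pullback (β M₂) v ≡ just j × _~_ G u v
      touching i j with nonempty M₁ i | nonempty M₂ j
      ... | (a , βa) | (b , βb) =
        Inside.element a , Outside.element b ,
        trans (L₁.pullback-image (β M₁) a) βa , trans (L₂.pullback-image (β M₂) b) βb ,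
        complete _ _ (Inside.element-∈ a) (outside b)

    module C {t₁ t₂} (M₁ : KModel Inside-graph t₁) (M₂ : KModel Outside-graph t₂) =
      Combine G (L₁.lift M₁) (L₂.lift M₂) (disjoint M₁ M₂) (touching M₁ M₂)

  joinModel : ∀ {t₁ t₂} → HasCliqueMinor Inside-graph t₁ → HasCliqueMinor Outside-graph t₂ →
              HasCliqueMinor G (t₁ + t₂)
  joinModel M₁ M₂ = C.combined M₁ M₂

  joinModel₂ : ∀ {t₁ t₂} → HasCliqueMinor₂ Inside-graph t₁ → HasCliqueMinor₂ Outside-graph t₂ →
               HasCliqueMinor₂ G (t₁ + t₂)
  joinModel₂ (M₁ , small₁) (M₂ , small₂) =
    C.combined M₁ M₂ , C.combined-small M₁ M₂ (L₁.lift-small M₁ small₁) (L₂.lift-small M₂ small₂)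

  joinColoring : ∀ {t₁ t₂} → Colorable Inside-graph t₁ → Colorable Outside-graph t₂ → Colorable G (t₁ + t₂)
  joinColoring {t₁} {t₂} (κ₁ , proper₁) (κ₂ , proper₂) = κ , λ u v → proper u v (p u) (p v) refl refl
    where
    κ′ : ∀ x b → p x ≡ b → Fin (t₁ + t₂)
    κ′ x true  px = κ₁ (Inside.index x px) ↑ˡ t₂
    κ′ x false px = t₁ ↑ʳ κ₂ (Outside.index x (cong not px))
    κ : Fin (n G) → Fin (t₁ + t₂)
    κ x = κ′ x (p x) refl
    proper : ∀ u v bu bv (pu : p u ≡ bu) (pv : p v ≡ bv) → _~_ G u v → κ′ u bu pu ≢ κ′ v bv pv
    proper u v true true pu pv u~v e =
      proper₁ _ _ (subst₂ (_~_ G) (sym (Inside.element-index u pu)) (sym (Inside.element-index v pv)) u~v)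
              (↑ˡ-injective t₂ _ _ e)
    proper u v false false pu pv u~v e =
      proper₂ _ _ (subst₂ (_~_ G) (sym (Outside.element-index u (cong not pu)))
                                  (sym (Outside.element-index v (cong not pv))) u~v)
              (↑ʳ-injective t₁ _ _ e)
    proper u v true  false _ _ _ = ↑ˡ≢↑ʳ _ _
    proper u v false true  _ _ _ = ↑ˡ≢↑ʳ _ _ ∘ sym

record CliqueMinorNotion : Set₁ where
  field
    Model    : Graph → ℕ → Set
    empty    : ∀ G → Model G 0
    size≤    : ∀ G {t} → Model G t → t ≤ n G
    lift     : ∀ G {m} {g : Fin m → Fin (n G)} → Injective _≡_ _≡_ g → ∀ {t} → Model (induced G g) t → Model G t
    complete : ∀ G → Complete G → Model G (n G)
    join     : ∀ G p complete → ∀ {t₁ t₂} → Model (Join.Inside-graph G p complete) t₁ →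
               Model (Join.Outside-graph G p complete) t₂ → Model G (t₁ + t₂)

minors : CliqueMinorNotion
minors = record
  { Model    = HasCliqueMinor
  ; empty    = proj₁ ∘ emptyModel
  ; size≤    = model-size≤
  ; lift     = λ G g-inj → Lift.lift G g-inj
  ; complete = λ G → proj₁ ∘ completeModel G
  ; join     = Join.joinModel
  }

smallMinors : CliqueMinorNotion
smallMinors = record
  { Model    = HasCliqueMinor₂
  ; empty    = emptyModel
  ; size≤    = λ G → model-size≤ G ∘ proj₁
  ; lift     = λ G g-inj → Lift.lift₂ G g-inj
  ; complete = completeModel
  ; join     = Join.joinModel₂
  }

-- Matchings of a relation, as partial involutions

module Pairings {n : ℕ} (E : Fin n → Fin n → Set)
  (E-sym : ∀ {x y} → E x y → E y x) (E-irrefl : ∀ {x} → ¬ E x x) where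

  record Pairing : Set where
    field
      partner     : Fin n → Maybe (Fin n)
      partner-sym : ∀ {x y} → partner x ≡ just y → partner y ≡ just x
      partner-E   : ∀ {x y} → partner x ≡ just y → E x y

    unpaired : Fin n → Bool
    unpaired = is-nothing ∘ partner

    deficiency : ℕ
    deficiency = count unpaired

    mate : Fin n → Fin n
    mate x = fromMaybe x (partner x)

    mate-involutive : ∀ x → mate (mate x) ≡ x
    mate-involutive x with partner x in px
    ... | nothing = cong (fromMaybe x) px
    ... | just y  = cong (fromMaybe y) (partner-sym px)

    leader : Fin n → Bool
    leader x = maybe (λ y → does (x Fin.<? y)) true (partner x)

    leaders : ℕ
    leaders = count leader

    leader-unpaired : ∀ {x} → partner x ≡ nothing → leader x ≡ true
    leader-unpaired {x} px = cong (maybe (λ y → does (x Fin.<? y)) true) px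

    leader-paired : ∀ {x y} → partner x ≡ just y → leader x ≡ does (x Fin.<? y)
    leader-paired {x} px = cong (maybe (λ y → does (x Fin.<? y)) true) px

    exactly-one-leader : ∀ {x y} → partner x ≡ just y → indicator (leader x) + indicator (leader y) ≡ 1
    exactly-one-leader {x} {y} px
      rewrite leader-paired px | leader-paired (partner-sym px) with Fin.<-cmp x y
    ... | tri< x<y _ y≮x rewrite dec-true (x Fin.<? y) x<y | dec-false (y Fin.<? x) y≮x = refl
    ... | tri> x≮y _ y<x rewrite dec-false (x Fin.<? y) x≮y | dec-true (y Fin.<? x) y<x = refl
    ... | tri≈ _ refl _ = ⊥-elim (E-irrefl (partner-E px))

    mate-leader : ∀ x → indicator (leader x) + indicator (leader (mate x)) ≡ 1 + indicator (unpaired x)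
    mate-leader x with partner x in px
    ... | nothing = cong (λ b → 1 + indicator b) (leader-unpaired px)
    ... | just y  = subst (λ b → indicator b + indicator (leader y) ≡ 1) (leader-paired px) (exactly-one-leader px)

    mate-permutation : Permutation′ n
    mate-permutation = permutation mate mate mate-involutive mate-involutive

    -- Summing leader x + leader (mate x) counts paired vertices once and unpaired ones twice.
    size+deficiency≡2*leaders : n + deficiency ≡ 2 * leaders
    size+deficiency≡2*leaders = begin
      n + deficiency
        ≡⟨ cong (_+ deficiency) (trans (sym (*-identityʳ n)) (sym (sum-const n 1))) ⟩
      sum {n} (λ _ → 1) + deficiency
        ≡⟨ ∑-distrib-+ (λ _ → 1) (indicator ∘ unpaired) ⟨
      sum (λ x → 1 + indicator (unpaired x))
        ≡⟨ sum-cong-≗ mate-leader ⟨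
      sum (λ x → indicator (leader x) + indicator (leader (mate x)))
        ≡⟨ ∑-distrib-+ (indicator ∘ leader) (indicator ∘ leader ∘ mate) ⟩
      leaders + sum (indicator ∘ leader ∘ mate)
        ≡⟨ cong (leaders +_) (sum-permute (indicator ∘ leader) mate-permutation) ⟨
      leaders + leaders
        ≡⟨ cong (leaders +_) (+-identityʳ leaders) ⟨
      2 * leaders ∎
      where open ≡-Reasoning

    representative : Fin n → Fin n
    representative x = if leader x then x else mate x

    representative-leader : ∀ x → leader (representative x) ≡ true
    representative-leader x with leader x in lx
    ... | true  = lx
    ... | false with partner x in px
    ...   | nothing = case lx of λ ()
    ...   | just y  = indicators≡1 (exactly-one-leader px) (trans (leader-paired px) lx)

    same-representative : ∀ {u v} → representative u ≡ representative v → u ≡ v ⊎ mate u ≡ v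
    same-representative {u} {v} e with leader u | leader v
    ... | true  | true  = inj₁ e
    ... | true  | false = inj₂ (trans (cong mate e) (mate-involutive v))
    ... | false | true  = inj₂ e
    ... | false | false = inj₁ (trans (sym (mate-involutive u)) (trans (cong mate e) (mate-involutive v)))

    partner-not-leader : ∀ {x y} → partner x ≡ just y → leader x ≡ true → leader y ≡ false
    partner-not-leader {y = y} px lx with exactly-one-leader px
    ... | e rewrite lx with leader y
    ...   | false = refl

    mate-E : ∀ {u v} → mate u ≡ v → u ≢ v → E u v
    mate-E {u} mu≡v u≢v with partner u in pu
    ... | nothing = ⊥-elim (u≢v mu≡v)
    ... | just y  = subst (E u) mu≡v (partner-E pu)

-- Colorings versus pairings of non-adjacent vertices

NonEdge-irrefl : ∀ G {x} → ¬ NonEdge G x x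
NonEdge-irrefl G (x≢x , _) = x≢x refl

module ComplementPairings (G : Graph) = Pairings (NonEdge G) (NonEdge-sym G) (NonEdge-irrefl G)

module _ (G : Graph) where
  open ComplementPairings G
  open Pairing

  pairing⇒coloring : (M : Pairing) → Colorable G (leaders M)
  pairing⇒coloring M = Colorable-weaken G (color , proper) (≤-reflexive L.size≡count)
    where
    module L = Enumeration (enumerate (leader M))
    color : Fin (n G) → Fin L.size
    color x = L.index (representative M x) (representative-leader M x)
    proper : ∀ u v → _~_ G u v → color u ≢ color v
    proper u v u~v same with u ≟ v | same-representative M (begin
        representative M u          ≡⟨ L.element-index _ _ ⟨
        L.element (color u)        ≡⟨ cong L.element same ⟩
        L.element (color v)        ≡⟨ L.element-index _ _ ⟩
        representative M v          ∎)
      where open ≡-Reasoning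
    ... | yes refl | _           = ~-irr G u~v
    ... | no u≢v   | inj₁ u≡v    = u≢v u≡v
    ... | no u≢v   | inj₂ mate≡v = proj₂ (mate-E M mate≡v u≢v) u~v

  module ColorClasses (noTriple : NoIndependentTriple G) {k} (κ : Fin (n G) → Fin k)
    (proper : ∀ u v → _~_ G u v → κ u ≢ κ v) where

    Companion : Fin (n G) → Fin (n G) → Set
    Companion x y = y ≢ x × κ y ≡ κ x

    companion : Fin (n G) → Maybe (Fin (n G))
    companion x with any? (λ y → ¬? (y ≟ x) ×-dec (κ y ≟ κ x))
    ... | yes (y , _) = just y
    ... | no _        = nothing

    companion-just : ∀ {x y} → companion x ≡ just y → Companion x y
    companion-just {x} e with any? (λ y → ¬? (y ≟ x) ×-dec (κ y ≟ κ x))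
    companion-just refl | yes (_ , c) = c

    companion-nothing : ∀ {x y} → companion x ≡ nothing → ¬ Companion x y
    companion-nothing {x} {y} e c with any? (λ y → ¬? (y ≟ x) ×-dec (κ y ≟ κ x))
    ... | no none = none (y , c)

    sameColor-nonAdjacent : ∀ {x y} → κ x ≡ κ y → ¬ _~_ G x y
    sameColor-nonAdjacent κx≡κy x~y = proper _ _ x~y κx≡κy

    companion-unique : ∀ {x y z} → Companion x y → Companion x z → y ≡ z
    companion-unique {x} {y} {z} (y≢x , κy) (z≢x , κz) with y ≟ z
    ... | yes y≡z = y≡z
    ... | no  y≢z = ⊥-elim (noTriple (independentTriple G
            (y≢x ∘ sym , sameColor-nonAdjacent (sym κy))
            (z≢x ∘ sym , sameColor-nonAdjacent (sym κz))
            (y≢z , sameColor-nonAdjacent (trans κy (sym κz)))))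

    companion-sym : ∀ {x y} → companion x ≡ just y → companion y ≡ just x
    companion-sym {x} {y} e with companion-just e | companion y in cy
    ... | (y≢x , κy) | just z  = cong just (companion-unique (companion-just cy) (y≢x ∘ sym , sym κy))
    ... | (y≢x , κy) | nothing = ⊥-elim (companion-nothing cy (y≢x ∘ sym , sym κy))

    pairing : Pairing
    pairing = record
      { partner     = companion
      ; partner-sym = companion-sym
      ; partner-E   = λ e → let (y≢x , κy) = companion-just e in y≢x ∘ sym , sameColor-nonAdjacent (sym κy)
      }

    leaders≤colors : leaders pairing ≤ k
    leaders≤colors = subst (_≤ k) L.size≡count (injective⇒≤ {f = κ ∘ L.element} injective)
      where
      module L = Enumeration (enumerate (leader pairing))
      injective : Injective _≡_ _≡_ (κ ∘ L.element)
      injective {i} {j} same with L.element i ≟ L.element j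
      ... | yes e   = L.element-injective e
      ... | no  eᵢ≢eⱼ = case trans (sym (L.element-∈ j)) (partner-not-leader pairing partnered (L.element-∈ i)) of λ ()
        where
        partnered : companion (L.element i) ≡ just (L.element j)
        partnered with companion (L.element i) in c
        ... | just y  = cong just (companion-unique (companion-just c) (eᵢ≢eⱼ ∘ sym , sym same))
        ... | nothing = ⊥-elim (companion-nothing c (eᵢ≢eⱼ ∘ sym , sym same))

    alone⇒unpaired : ∀ v → (∀ x → κ x ≡ κ v → x ≡ v) → partner pairing v ≡ nothing
    alone⇒unpaired v alone with companion v in cv
    ... | nothing = refl
    ... | just y  = let (y≢v , κy) = companion-just cv in ⊥-elim (y≢v (alone y κy))

  χ-lower : NoIndependentTriple G → ∀ {c} → Colorable G c → n G ≤ 2 * c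
  χ-lower noTriple {c} (κ , proper) = begin
    n G                          ≤⟨ m≤m+n (n G) _ ⟩
    n G + deficiency pairing     ≡⟨ size+deficiency≡2*leaders pairing ⟩
    2 * leaders pairing          ≤⟨ *-monoʳ-≤ 2 leaders≤colors ⟩
    2 * c                        ∎
    where
    open ColorClasses noTriple κ proper
    open ≤-Reasoning

-- Gallai's lemma

module Gallai {n : ℕ} (E : Fin n → Fin n → Set)
  (E-sym : ∀ {x y} → E x y → E y x) (E-irrefl : ∀ {x} → ¬ E x x) where

  open Pairings E E-sym E-irrefl
  open Pairing

  Free : Pairing → Fin n → Set
  Free M x = partner M x ≡ nothing

  unpaired⇒free : ∀ M {x} → unpaired M x ≡ true → Free M x
  unpaired⇒free M {x} _ with partner M x
  ... | nothing = refl

  module Augment (M : Pairing) {u v} (u-free : Free M u) (v-free : Free M v) (uv : E u v) where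

    partner′ : Fin n → Maybe (Fin n)
    partner′ x with u ≟ x | v ≟ x
    ... | yes _ | _     = just v
    ... | no _  | yes _ = just u
    ... | no _  | no _  = partner M x

    u≢v : u ≢ v
    u≢v refl = E-irrefl uv

    partner′-u : partner′ u ≡ just v
    partner′-u with u ≟ u
    ... | yes _   = refl
    ... | no  u≢u = ⊥-elim (u≢u refl)

    partner′-v : partner′ v ≡ just u
    partner′-v with u ≟ v | v ≟ v
    ... | yes u≡v | _       = ⊥-elim (u≢v u≡v)
    ... | no _    | yes _   = refl
    ... | no _    | no  v≢v = ⊥-elim (v≢v refl)

    partner′-other : ∀ {x} → u ≢ x → v ≢ x → partner′ x ≡ partner M x
    partner′-other {x} u≢x v≢x with u ≟ x | v ≟ x
    ... | yes u≡x | _       = ⊥-elim (u≢x u≡x)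
    ... | no _    | yes v≡x = ⊥-elim (v≢x v≡x)
    ... | no _    | no _    = refl

    not-partnered-with-free : ∀ {w x y} → Free M w → partner M x ≡ just y → w ≢ y
    not-partnered-with-free w-free e refl = case trans (sym (partner-sym M e)) w-free of λ ()

    augmented : Pairing
    augmented = record { partner = partner′ ; partner-sym = sym′ ; partner-E = E′ }
      where
      sym′ : ∀ {x y} → partner′ x ≡ just y → partner′ y ≡ just x
      sym′ {x} e with u ≟ x | v ≟ x
      sym′ refl | yes refl | _        = partner′-v
      sym′ refl | no _     | yes refl = partner′-u
      sym′ e    | no _     | no _     =
        trans (partner′-other (not-partnered-with-free u-free e) (not-partnered-with-free v-free e)) (partner-sym M e)
      E′ : ∀ {x y} → partner′ x ≡ just y → E x y
      E′ {x} e with u ≟ x | v ≟ x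
      E′ refl | yes refl | _        = uv
      E′ refl | no _     | yes refl = E-sym uv
      E′ e    | no _     | no _     = partner-E M e

    deficiency-augmented : deficiency M ≡ deficiency augmented + 2
    deficiency-augmented = begin
      deficiency M                                            ≡⟨ sum-cong-≗ freed ⟩
      sum (λ x → indicator (unpaired augmented x) + (atU x + atV x))
        ≡⟨ ∑-distrib-+ (indicator ∘ unpaired augmented) (λ x → atU x + atV x) ⟩
      deficiency augmented + sum (λ x → atU x + atV x)        ≡⟨ cong (deficiency augmented +_) (∑-distrib-+ atU atV) ⟩
      deficiency augmented + (sum atU + sum atV)
        ≡⟨ cong (deficiency augmented +_) (cong₂ _+_ (sum-single u _) (sum-single v _)) ⟩
      deficiency augmented + 2                                ∎
      where
      open ≡-Reasoning
      atU atV : Fin n → ℕ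
      atU x = indicator (does (u ≟ x))
      atV x = indicator (does (v ≟ x))
      freed : ∀ x → indicator (unpaired M x) ≡ indicator (unpaired augmented x) + (atU x + atV x)
      freed x with u ≟ x | v ≟ x
      ... | yes refl | yes refl = ⊥-elim (u≢v refl)
      ... | yes refl | no _     rewrite u-free = refl
      ... | no _     | yes refl rewrite v-free = refl
      ... | no _     | no _     = sym (+-identityʳ _)

  module _ {W : Fin n → Set} (W? : Decidable W) where

    Closed : Pairing → Set
    Closed A = ∀ {x y} → W x → partner A x ≡ just y → W y

    choose : Pairing → Pairing → Fin n → Maybe (Fin n)
    choose A B x = if does (W? x) then partner A x else partner B x

    choose-inside : ∀ A B {x} → W x → choose A B x ≡ partner A x
    choose-inside A B {x} x∈W with W? x
    ... | yes _   = refl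
    ... | no  x∉W = ⊥-elim (x∉W x∈W)

    choose-outside : ∀ A B {x} → ¬ W x → choose A B x ≡ partner B x
    choose-outside A B {x} x∉W with W? x
    ... | yes x∈W = ⊥-elim (x∉W x∈W)
    ... | no  _   = refl

    patch : (A B : Pairing) → Closed A → Closed B → Pairing
    patch A B A-closed B-closed = record { partner = choose A B ; partner-sym = sym′ ; partner-E = E′ }
      where
      sym′ : ∀ {x y} → choose A B x ≡ just y → choose A B y ≡ just x
      sym′ {x} {y} e with W? x
      ... | yes x∈W = trans (choose-inside A B (A-closed x∈W e)) (partner-sym A e)
      ... | no  x∉W = trans (choose-outside A B (x∉W ∘ λ y∈W → B-closed y∈W (partner-sym B e))) (partner-sym B e)
      E′ : ∀ {x y} → choose A B x ≡ just y → E x y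
      E′ {x} e with W? x
      ... | yes _ = partner-E A e
      ... | no  _ = partner-E B e

    patch-deficiency : ∀ A B (A-closed : Closed A) (B-closed : Closed B) →
      deficiency (patch A B A-closed B-closed) + deficiency (patch B A B-closed A-closed) ≡ deficiency A + deficiency B
    patch-deficiency A B A-closed B-closed = begin
      deficiency (patch A B A-closed B-closed) + deficiency (patch B A B-closed A-closed)
        ≡⟨ ∑-distrib-+ (indicator ∘ is-nothing ∘ choose A B) (indicator ∘ is-nothing ∘ choose B A) ⟨
      sum (λ x → indicator (is-nothing (choose A B x)) + indicator (is-nothing (choose B A x)))
        ≡⟨ sum-cong-≗ exchanged ⟩
      sum (λ x → indicator (unpaired A x) + indicator (unpaired B x))
        ≡⟨ ∑-distrib-+ (indicator ∘ unpaired A) (indicator ∘ unpaired B) ⟩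
      deficiency A + deficiency B ∎
      where
      open ≡-Reasoning
      exchanged : ∀ x → indicator (is-nothing (choose A B x)) + indicator (is-nothing (choose B A x))
                      ≡ indicator (unpaired A x) + indicator (unpaired B x)
      exchanged x with W? x
      ... | yes _ = refl
      ... | no  _ = +-comm (indicator (unpaired B x)) (indicator (unpaired A x))

  module TwoPairings (M N : Pairing) where

    pairingAt : Bool → Pairing
    pairingAt true  = N
    pairingAt false = M

    -- The i-th step of an alternating walk follows N when i is even and M when i is odd.
    turn : ℕ → Bool
    turn zero    = true
    turn (suc i) = not (turn i)

    module Alternating {u} (u-free : Free M u) where

      walk : ℕ → Maybe (Fin n)
      walk zero    = just u
      walk (suc i) = maybe (partner (pairingAt (turn i))) nothing (walk i)

      Reached : Fin n → Set
      Reached x = ∃ λ i → walk i ≡ just x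

      follow : ∀ i {x y} → walk i ≡ just x → partner (pairingAt (turn i)) x ≡ just y → walk (suc i) ≡ just y
      follow i wi e = trans (cong (maybe _ nothing) wi) e

      arrival : ∀ i {y} → walk (suc i) ≡ just y → ∃ λ x → walk i ≡ just x × partner (pairingAt (turn i)) y ≡ just x
      arrival i e with walk i
      ... | just x = x , refl , partner-sym (pairingAt (turn i)) e

      retreat : ∀ i {x y} → walk (suc i) ≡ just x → partner (pairingAt (turn i)) x ≡ just y → walk i ≡ just y
      retreat i wi e with arrival i wi
      ... | (z , wz , back) = trans wz (trans (sym back) e)

      closed : ∀ b {x y} → Reached x → partner (pairingAt b) x ≡ just y → Reached y
      closed b (zero , refl) e with same-or-other b true
      ... | inj₁ refl = 1 , e
      ... | inj₂ refl = case trans (sym e) u-free of λ ()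
      closed b (suc j , wj) e with same-or-other b (turn j)
      ... | inj₁ refl = j , retreat j wj e
      ... | inj₂ refl = suc (suc j) , follow (suc j) wj e

      backtrack : (S : Fin n → Set) → (∀ b {x y} → S x → partner (pairingAt b) x ≡ just y → S y) →
                  ∀ {x} → Reached x → S x → S u
      backtrack S S-closed (i , wi) = back i wi
        where
        back : ∀ i {x} → walk i ≡ just x → S x → S u
        back zero    refl s = s
        back (suc j) wj   s = let (z , wz , toZ) = arrival j wj in back j wz (S-closed (turn j) s toZ)

      free-end : ∀ b i {x} → walk i ≡ just x → Free (pairingAt b) x → i ≡ 0 ⊎ (turn i ≡ b × walk (suc i) ≡ nothing)
      free-end b zero    wi free = inj₁ refl
      free-end b (suc j) wj free with same-or-other b (turn j)
      ... | inj₁ refl = let (_ , _ , back) = arrival j wj in case trans (sym back) free of λ ()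
      ... | inj₂ refl = inj₂ (refl , trans (cong (maybe _ nothing) wj) free)

      stays-ended : ∀ i → walk (suc i) ≡ nothing → ∀ d → walk (suc (d + i)) ≡ nothing
      stays-ended i ended zero    = ended
      stays-ended i ended (suc d) = cong (maybe _ nothing) (stays-ended i ended d)

      before-end : ∀ i e {x} → walk (suc i) ≡ nothing → walk e ≡ just x → e ≤ i
      before-end i e ended we with e ≤? i
      ... | yes e≤i = e≤i
      ... | no  e≰i = case trans (sym we) (subst (λ k → walk k ≡ nothing) e≡ (stays-ended i ended (e ∸ suc i))) of λ ()
        where
        e≡ : suc (e ∸ suc i + i) ≡ e
        e≡ = trans (sym (+-suc (e ∸ suc i) i)) (m∸n+n≡m (≰⇒> e≰i))

      -- The walk has a single far end: a vertex free in M ends it after an N-step,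
      -- one free in N after an M-step.
      free-in-M-is-start : ∀ {v w} → Reached v → Free M v → Reached w → Free N w → ¬ Free N u → u ≡ v
      free-in-M-is-start (i , wi) v-free (e , we) w-free u-paired with free-end false i wi v-free
      ... | inj₁ refl = just-injective wi
      ... | inj₂ (turn-i , end-i) with free-end true e we w-free
      ...   | inj₁ refl = ⊥-elim (u-paired (subst (Free N) (sym (just-injective we)) w-free))
      ...   | inj₂ (turn-e , end-e) = case trans (sym turn-e) (trans (cong turn e≡i) turn-i) of λ ()
        where
        e≡i : e ≡ i
        e≡i = ≤-antisym (before-end i e end-i we) (before-end e i end-e wi)

  module _ (D : ℕ) (minimum : ∀ M → D ≤ deficiency M)
    (avoidable : ∀ v → DoubleNegation (∃ λ M → deficiency M ≤ D × Free M v)) where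

    Maximum : Pairing → Set
    Maximum M = deficiency M ≤ D

    no-augmenting-edge : ∀ M → Maximum M → ∀ {u v} → Free M u → Free M v → ¬ E u v
    no-augmenting-edge M maximum u-free v-free uv = <⇒≱ smaller (minimum augmented)
      where
      open Augment M u-free v-free uv
      smaller : deficiency augmented < D
      smaller = begin-strict
        deficiency augmented      <⟨ m<m+n (deficiency augmented) (s≤s z≤n) ⟩
        deficiency augmented + 2  ≡⟨ deficiency-augmented ⟨
        deficiency M              ≤⟨ maximum ⟩
        D                         ∎
        where open ≤-Reasoning

    patch-maximum : ∀ {W} (W? : Decidable W) A B (A-closed : Closed W? A) (B-closed : Closed W? B) →
                    Maximum A → Maximum B → Maximum (patch W? A B A-closed B-closed)
    patch-maximum W? A B A-closed B-closed maxA maxB = +-cancelʳ-≤ (deficiency Q) (deficiency P) D (begin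
      deficiency P + deficiency Q   ≡⟨ patch-deficiency W? A B A-closed B-closed ⟩
      deficiency A + deficiency B   ≤⟨ +-mono-≤ maxA maxB ⟩
      D + D                         ≤⟨ +-monoʳ-≤ D (minimum Q) ⟩
      D + deficiency Q              ∎)
      where
      open ≤-Reasoning
      P Q : Pairing
      P = patch W? A B A-closed B-closed
      Q = patch W? B A B-closed A-closed

    -- For M-free u, v with u – w – ⋯ – v: w is M-matched, and some maximum N misses w.
    -- Swapping M and N along the alternating walk from u (resp. v) shows that this walk reaches w,
    -- so the walk from u reaches v as well, and both v and w would be its far end unless u ≡ v.
    free-neighbour-step : ∀ M → Maximum M → ∀ {u w v} → E u w → Free M u → Free M v →
                          (∀ M′ → Maximum M′ → Free M′ w → Free M′ v → w ≡ v) → u ≡ v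
    free-neighbour-step M maxM {u} {w} {v} uw u-free v-free w≡v-if-free = decidable-stable (u ≟ v) do
      (N , maxN , w-free) ← avoidable w
      fromU? ← ¬¬-decidable (TwoPairings.Alternating.Reached M N u-free)
      fromV? ← ¬¬-decidable (TwoPairings.Alternating.Reached M N v-free)
      return (exchange N maxN w-free fromU? fromV?)
      where
      w-matched : ¬ Free M w
      w-matched w-free = no-augmenting-edge M maxM u-free w-free uw

      exchange : ∀ N → Maximum N → Free N w →
                 Decidable (TwoPairings.Alternating.Reached M N u-free) →
                 Decidable (TwoPairings.Alternating.Reached M N v-free) → u ≡ v
      exchange N maxN w-free fromU? fromV? =
        U.free-in-M-is-start (V.backtrack U.Reached U.closed w∈V w∈U) v-free w∈U w-free u-matched
        where
        open TwoPairings M N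
        module U = Alternating u-free
        module V = Alternating v-free

        u-matched : ¬ Free N u
        u-matched u-free′ = no-augmenting-edge N maxN u-free′ w-free uw

        w∈U : U.Reached w
        w∈U with fromU? w
        ... | yes reached = reached
        ... | no  w∉U     = ⊥-elim (no-augmenting-edge
                              (patch fromU? M N (U.closed false) (U.closed true))
                              (patch-maximum fromU? M N (U.closed false) (U.closed true) maxM maxN)
                              (trans (choose-inside fromU? M N (0 , refl)) u-free)
                              (trans (choose-outside fromU? M N w∉U) w-free) uw)

        w∈V : V.Reached w
        w∈V with fromV? w
        ... | yes reached = reached
        ... | no  w∉V     = ⊥-elim (w-matched (subst (Free M) (sym w≡v) v-free))
          where
          w≡v : w ≡ v
          w≡v = w≡v-if-free (patch fromV? M N (V.closed false) (V.closed true))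
                  (patch-maximum fromV? M N (V.closed false) (V.closed true) maxM maxN)
                  (trans (choose-outside fromV? M N w∉V) w-free)
                  (trans (choose-inside fromV? M N (0 , refl)) v-free)

    free-vertices-equal : ∀ M → Maximum M → ∀ {u v} → Star E u v → Free M u → Free M v → u ≡ v
    free-vertices-equal M maxM ε         _      _      = refl
    free-vertices-equal M maxM (uw ◅ wv) u-free v-free =
      free-neighbour-step M maxM uw u-free v-free λ M′ maxM′ → free-vertices-equal M′ maxM′ wv

    factor-critical : (∀ u v → DoubleNegation (Star E u v)) → Fin n → D ≤ 1
    factor-critical connected v₀ = decidable-stable (D ≤? 1) do
      (M₀ , maxM₀ , _) ← avoidable v₀
      M₀-small ← ¬¬-excluded-middle {A = deficiency M₀ ≤ 1}
      case M₀-small of λ where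
        (yes ≤1) → return (≤-trans (minimum M₀) ≤1)
        (no  >1) → do
          let (a , b , a≢b , a-free , b-free) = Enumeration.two-elements (enumerate (unpaired M₀))
                (subst (2 ≤_) (sym (Enumeration.size≡count (enumerate (unpaired M₀)))) (≰⇒> >1))
          path ← connected a b
          ⊥-elim (a≢b (free-vertices-equal M₀ maxM₀ path (unpaired⇒free M₀ a-free) (unpaired⇒free M₀ b-free)))

-- Minimal counterexamples

module Deletion (G : Graph) (v : Fin (n G)) where

  module Others = Enumeration (enumerate (λ x → not (does (x ≟ v))))

  G-v : Graph
  G-v = induced G Others.element

  size< : Others.size < n G
  size< = Others.size< {v} (cong not (dec-true (v ≟ v) refl))

  extend : ∀ {t} → Colorable G-v t →
           Σ (Fin (n G) → Fin (suc t)) λ κ → (∀ x y → _~_ G x y → κ x ≢ κ y) × (∀ x → κ x ≡ κ v → x ≡ v)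
  extend {t} (κ′ , proper′) = κ , proper , alone
    where
    κ : Fin (n G) → Fin (suc t)
    κ x with x ≟ v
    ... | yes _   = fromℕ t
    ... | no  x≢v = inject₁ (κ′ (Others.index x (cong not (dec-false (x ≟ v) x≢v))))
    κv : κ v ≡ fromℕ t
    κv with v ≟ v
    ... | yes _   = refl
    ... | no  v≢v = ⊥-elim (v≢v refl)
    proper : ∀ x y → _~_ G x y → κ x ≢ κ y
    proper x y x~y with x ≟ v | y ≟ v
    ... | yes refl | yes refl = ⊥-elim (~-irr G x~y)
    ... | yes _    | no  _    = fromℕ≢inject₁
    ... | no  _    | yes _    = fromℕ≢inject₁ ∘ sym
    ... | no  x≢v  | no  y≢v  =
      proper′ _ _ (subst₂ (_~_ G) (sym (Others.element-index _ _)) (sym (Others.element-index _ _)) x~y)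
      ∘ inject₁-injective
    alone : ∀ x → κ x ≡ κ v → x ≡ v
    alone x κx≡κv with x ≟ v
    ... | yes x≡v = x≡v
    ... | no  _   = ⊥-elim (fromℕ≢inject₁ (sym (trans κx≡κv κv)))

module Counterexamples (O : CliqueMinorNotion) where
  open CliqueMinorNotion O

  IsLargestModel : Graph → ℕ → Set
  IsLargestModel G h = Model G h × (∀ t → Model G t → t ≤ h)

  ¬¬-had : ∀ G → DoubleNegation (∃ (IsLargestModel G))
  ¬¬-had G = ¬¬-greatest (Model G) (empty G) (λ _ → size≤ G)

  IsLargestModel-unique : ∀ G {h h′} → IsLargestModel G h → IsLargestModel G h′ → h ≡ h′
  IsLargestModel-unique G (model , greatest) (model′ , greatest′) = ≤-antisym (greatest′ _ model) (greatest _ model′)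

  Counterexample : Graph → Set
  Counterexample G = IsAlpha G 2 × (∀ h c → IsLargestModel G h → IsChi G c → h < c)

  counterexample : ∀ G → IsAlpha G 2 → ∀ {h c} → IsLargestModel G h → IsChi G c → h < c → Counterexample G
  counterexample G α₂ isHad isChi h<c =
    α₂ , λ _ _ isHad′ isChi′ → subst₂ _<_ (IsLargestModel-unique G isHad isHad′) (IsChi-unique G isChi isChi′) h<c

  no-minimal⇒no-counterexample : (∀ G → ¬ Minimal Counterexample G) → ∀ G → ¬ Counterexample G
  no-minimal⇒no-counterexample noMinimal G = <-rec (λ k → ∀ G → n G ≡ k → ¬ Counterexample G) noneOfSize (n G) G refl
    where
    noneOfSize : ∀ k → (∀ {j} → j < k → ∀ G → n G ≡ j → ¬ Counterexample G) → ∀ G → n G ≡ k → ¬ Counterexample G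
    noneOfSize _ smaller G refl ce = noMinimal G (ce , λ m f m<n _ → smaller m<n (induced G f) refl)

  no-counterexample⇒conjecture : (∀ G → ¬ Counterexample G) →
                                 ∀ G → IsAlpha G 2 → ∀ h c → IsLargestModel G h → IsChi G c → c ≤ h
  no-counterexample⇒conjecture none G α₂ h c isHad isChi = ≮⇒≥ λ h<c → none G (counterexample G α₂ isHad isChi h<c)

  module Minimality (G : Graph) (α₂ : IsAlpha G 2) {h c} (isHad : IsLargestModel G h) (isChi : IsChi G c) (h<c : h < c)
    (minimal : ∀ m (f : Fin m → Fin (n G)) → m < n G → Injective _≡_ _≡_ f → ¬ Counterexample (induced G f)) where

    open ComplementPairings G
    open Pairing

    noTriple : NoIndependentTriple G
    noTriple = α≡2⇒noIndependentTriple G α₂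

    proper-subgraph-HC : ∀ {m} {f : Fin m → Fin (n G)} → m < n G → Injective _≡_ _≡_ f →
                      DoubleNegation (∃ λ t → Model (induced G f) t × Colorable (induced G f) t)
    proper-subgraph-HC {m} {f} m<n f-inj with nonEdgeOrComplete (induced G f)
    ... | inj₂ complete′ = return (m , complete (induced G f) complete′ , Colorable-trivial (induced G f))
    ... | inj₁ (x , y , xy) = do
      (h′ , isHad′) ← ¬¬-had (induced G f)
      (c′ , isChi′) ← ¬¬-χ (induced G f)
      let α₂′ = α≡2 (induced G f) (noIndependentTriple-induced G f-inj noTriple) xy
      return (h′ , proj₁ isHad′ , Colorable-weaken (induced G f) (proj₁ isChi′)
        (≮⇒≥ λ h′<c′ → minimal m f m<n f-inj (counterexample _ α₂′ isHad′ isChi′ h′<c′)))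

    2χ≤n+deficiency : ∀ M → 2 * c ≤ n G + deficiency M
    2χ≤n+deficiency M = begin
      2 * c                    ≤⟨ *-monoʳ-≤ 2 (proj₂ isChi _ (pairing⇒coloring G M)) ⟩
      2 * leaders M            ≡⟨ size+deficiency≡2*leaders M ⟨
      n G + deficiency M       ∎
      where open ≤-Reasoning

    pairing-avoiding : ∀ v → DoubleNegation (∃ λ M → n G + deficiency M ≤ 2 * c × partner M v ≡ nothing)
    pairing-avoiding v = do
      (t , model , coloring) ← proper-subgraph-HC size< Others.element-injective
      let (κ , proper , alone) = extend coloring
          open ColorClasses G noTriple κ proper
          t<c : t < c
          t<c = ≤-<-trans (proj₂ isHad t (lift G Others.element-injective model)) h<c
      return (pairing , (begin
        n G + deficiency pairing  ≡⟨ size+deficiency≡2*leaders pairing ⟩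
        2 * leaders pairing       ≤⟨ *-monoʳ-≤ 2 (≤-trans leaders≤colors t<c) ⟩
        2 * c                     ∎) , alone⇒unpaired v alone)
      where
      open Deletion G v
      open ≤-Reasoning

    complement-connected : ∀ u v → DoubleNegation (Star (NonEdge G) u v)
    complement-connected u v = do
      reachable? ← ¬¬-decidable (Star (NonEdge G) u)
      case reachable? v of λ where
        (yes path)   → return path
        (no  noPath) → disconnected reachable? noPath >>= ⊥-elim
      where
      disconnected : Decidable (Star (NonEdge G) u) → ¬ Star (NonEdge G) u v → DoubleNegation ⊥
      disconnected reachable? noPath = do
        (t₁ , model₁ , coloring₁) ← proper-subgraph-HC (J.Inside.size< v-unreached) J.Inside.element-injective
        (t₂ , model₂ , coloring₂) ← proper-subgraph-HC (J.Outside.size< u-reached) J.Outside.element-injective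
        return (<⇒≱ h<c (≤-trans (proj₂ isChi _ (J.joinColoring coloring₁ coloring₂))
                                   (proj₂ isHad _ (join G p joined model₁ model₂))))
        where
        p : Fin (n G) → Bool
        p x = does (reachable? x)
        joined : ∀ x y → p x ≡ true → p y ≡ false → _~_ G x y
        joined x y px py with reachable? x | reachable? y
        ... | yes path | no unreached = decidable-stable (~-dec G x y) λ x≁y →
                unreached (path ◅◅ ((λ { refl → unreached path }) , x≁y) ◅ ε)
        module J = Join G p joined
        v-unreached : p v ≡ false
        v-unreached = dec-false (reachable? v) noPath
        u-reached : not (p u) ≡ false
        u-reached = cong not (dec-true (reachable? u) ε)

    plummer-stiebitz-toft : 2 * c ≤ n G + 1
    plummer-stiebitz-toft = begin
      2 * c                    ≤⟨ m≤n+m∸n (2 * c) (n G) ⟩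
      n G + (2 * c ∸ n G)      ≤⟨ +-monoʳ-≤ (n G) (factor-critical D minimum avoidable complement-connected v₀) ⟩
      n G + 1                  ∎
      where
      open ≤-Reasoning
      open Gallai (NonEdge G) (NonEdge-sym G) (NonEdge-irrefl G)
      -- By 2χ≤n+deficiency and pairing-avoiding, D is the deficiency of a maximum pairing.
      D : ℕ
      D = 2 * c ∸ n G
      minimum : ∀ M → D ≤ deficiency M
      minimum M = m≤n+o⇒m∸n≤o (2 * c) (n G) (2χ≤n+deficiency M)
      avoidable : ∀ v → DoubleNegation (∃ λ M → deficiency M ≤ D × Free M v)
      avoidable v = do
        (M , bound , v-free) ← pairing-avoiding v
        return (M , m+n≤o⇒m≤o∸n (deficiency M) (subst (_≤ 2 * c) (+-comm (n G) (deficiency M)) bound) , v-free)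
      v₀ : Fin (n G)
      v₀ = proj₁ (proj₁ α₂) zero

  minimal-counterexample-bound : ∀ G → Minimal Counterexample G → ∀ {h c} → IsLargestModel G h → IsChi G c →
                                 h < c × 2 * c ≤ n G + 1
  minimal-counterexample-bound G ((α₂ , had<χ) , minimal) isHad isChi =
    had<χ _ _ isHad isChi , Minimality.plummer-stiebitz-toft G α₂ isHad isChi (had<χ _ _ isHad isChi) minimal

  conjecture-from-half : (Half : Graph → ℕ → Set) → (∀ G {h c} → Half G h → h < c → 2 * c ≤ n G + 1 → ⊥) →
                         (∀ G → IsAlpha G 2 → ∀ h → IsLargestModel G h → Half G h) →
                         ∀ G → IsAlpha G 2 → ∀ h c → IsLargestModel G h → IsChi G c → c ≤ h
  conjecture-from-half Half refutes half = no-counterexample⇒conjecture (no-minimal⇒no-counterexample noMinimal)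
    where
    noMinimal : ∀ G → ¬ Minimal Counterexample G
    noMinimal G minimal@((α₂ , _) , _) = refuted λ ()
      where
      refuted : DoubleNegation ⊥
      refuted = do
        (h , isHad) ← ¬¬-had G
        (c , isChi) ← ¬¬-χ G
        let (h<c , bound) = minimal-counterexample-bound G minimal isHad isChi
        return (refutes G (half G α₂ h isHad) h<c bound)

⌈/2⌉≤ : ∀ {n t} → n ≤ 2 * t → ⌈ n /2⌉ ≤ t
⌈/2⌉≤ {n} {t} n≤2t =
  subst (⌈ n /2⌉ ≤_) (sym (n≡⌈n+n/2⌉ t)) (⌈n/2⌉-mono (subst (n ≤_) (cong (t +_) (+-identityʳ t)) n≤2t))

≤⌈/2⌉ : ∀ {c n} → 2 * c ≤ n + 1 → c ≤ ⌈ n /2⌉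
≤⌈/2⌉ {c} {n} 2c≤n+1 =
  subst (_≤ ⌈ n /2⌉) (sym (n≡⌊n+n/2⌋ c)) (⌊n/2⌋-mono (subst₂ _≤_ (cong (c +_) (+-identityʳ c)) (+-comm n 1) 2c≤n+1))

≤2*⌈/2⌉ : ∀ n → n ≤ 2 * ⌈ n /2⌉
≤2*⌈/2⌉ n = begin
  n                          ≡⟨ ⌊n/2⌋+⌈n/2⌉≡n n ⟨
  ⌊ n /2⌋ + ⌈ n /2⌉          ≤⟨ +-monoˡ-≤ ⌈ n /2⌉ (⌊n/2⌋≤⌈n/2⌉ n) ⟩
  ⌈ n /2⌉ + ⌈ n /2⌉          ≡⟨ cong (⌈ n /2⌉ +_) (+-identityʳ ⌈ n /2⌉) ⟨
  2 * ⌈ n /2⌉                ∎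
  where open ≤-Reasoning

⌈/2⌉≤-part : ∀ {n a b} → a + b ≡ n → ⌈ n /2⌉ ≤ a ⊎ ⌈ n /2⌉ ≤ b
⌈/2⌉≤-part {n} {a} {b} a+b≡n with b ≤? a
... | yes b≤a = inj₁ (⌈/2⌉≤ (begin
  n            ≡⟨ a+b≡n ⟨
  a + b        ≤⟨ +-monoʳ-≤ a (≤-trans b≤a (≤-reflexive (sym (+-identityʳ a)))) ⟩
  2 * a        ∎))
  where open ≤-Reasoning
... | no  b≰a = inj₂ (⌈/2⌉≤ (begin
  n            ≡⟨ a+b≡n ⟨
  a + b        ≤⟨ +-monoˡ-≤ b (≰⇒≥ b≰a) ⟩
  b + b        ≡⟨ cong (b +_) (+-identityʳ b) ⟨
  2 * b        ∎))
  where open ≤-Reasoning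

-- Connected dominating matchings

module MatchingModel (G : Graph) (M : Matching G) (connected : ConnectedMatching M) where
  open Matching M using (m; a; b; edge; ab-dis; a-inj; b-inj)

  endpoint? : ∀ x → Dec (Covered M x)
  endpoint? x = any? λ i → (x ≟ a i) ⊎-dec (x ≟ b i)

  covered : Fin (n G) → Bool
  covered x = does (endpoint? x)

  covered⇒Covered : ∀ {x} → covered x ≡ true → Covered M x
  covered⇒Covered {x} _ with endpoint? x
  ... | yes c = c

  same-edge : ∀ {x i j} → Endpoint M i x → Endpoint M j x → i ≡ j
  same-edge (inj₁ refl) (inj₁ e) = a-inj e
  same-edge (inj₂ refl) (inj₂ e) = b-inj e
  same-edge (inj₁ refl) (inj₂ e) = ⊥-elim (ab-dis _ _ e)
  same-edge (inj₂ refl) (inj₁ e) = ⊥-elim (ab-dis _ _ (sym e))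

  edgeAt : Fin (n G) → Maybe (Fin m)
  edgeAt x with endpoint? x
  ... | yes (i , _) = just i
  ... | no  _       = nothing

  edgeAt-endpoint : ∀ {x i} → Endpoint M i x → edgeAt x ≡ just i
  edgeAt-endpoint {x} e with endpoint? x
  ... | yes (j , e′)  = cong just (same-edge e′ e)
  ... | no  uncovered = ⊥-elim (uncovered (_ , e))

  edgeAt-just : ∀ {x i} → edgeAt x ≡ just i → Endpoint M i x
  edgeAt-just {x} e with endpoint? x
  edgeAt-just refl | yes (_ , e′) = e′

  edgeAt-uncovered : ∀ {x} → covered x ≡ false → edgeAt x ≡ nothing
  edgeAt-uncovered {x} _ with endpoint? x
  ... | no _ = refl

  model : HasCliqueMinor₂ G m
  model = record { β = edgeAt ; nonempty = nonempty′ ; connected = connected′ ; adjacent = adjacent′ } , small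
    where
    nonempty′ : ∀ i → ∃ λ v → edgeAt v ≡ just i
    nonempty′ i = a i , edgeAt-endpoint (inj₁ refl)
    connected′ : ∀ i → ConnectedIn G (λ v → edgeAt v ≡ just i)
    connected′ i u v eu ev with edgeAt-just eu | edgeAt-just ev
    ... | inj₁ refl | inj₁ refl = here eu
    ... | inj₂ refl | inj₂ refl = here eu
    ... | inj₁ refl | inj₂ refl = step eu (edge i) (here ev)
    ... | inj₂ refl | inj₁ refl = step eu (~-sym G (edge i)) (here ev)
    adjacent′ : ∀ i j → i ≢ j → ∃ λ u → ∃ λ v → edgeAt u ≡ just i × edgeAt v ≡ just j × _~_ G u v
    adjacent′ i j _ = let (x , y , ex , ey , x~y) = connected i j in
      x , y , edgeAt-endpoint ex , edgeAt-endpoint ey , x~y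
    small : ∀ i u v w → edgeAt u ≡ just i → edgeAt v ≡ just i → edgeAt w ≡ just i → u ≡ v ⊎ u ≡ w ⊎ v ≡ w
    small i u v w eu ev ew with edgeAt-just eu | edgeAt-just ev | edgeAt-just ew
    ... | inj₁ p | inj₁ q | _      = inj₁ (trans p (sym q))
    ... | inj₂ p | inj₂ q | _      = inj₁ (trans p (sym q))
    ... | inj₁ p | inj₂ _ | inj₁ r = inj₂ (inj₁ (trans p (sym r)))
    ... | inj₁ _ | inj₂ q | inj₂ r = inj₂ (inj₂ (trans q (sym r)))
    ... | inj₂ _ | inj₁ q | inj₁ r = inj₂ (inj₂ (trans q (sym r)))
    ... | inj₂ p | inj₁ _ | inj₂ r = inj₂ (inj₁ (trans p (sym r)))

  side : ∀ {x} → Covered M x → Fin m ⊎ Fin m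
  side (i , inj₁ _) = inj₁ i
  side (i , inj₂ _) = inj₂ i

  side-injective : ∀ {x y} (cx : Covered M x) (cy : Covered M y) → side cx ≡ side cy → x ≡ y
  side-injective (i , inj₁ refl) (j , inj₁ refl) refl = refl
  side-injective (i , inj₂ refl) (j , inj₂ refl) refl = refl

  count-covered : count covered ≤ 2 * m
  count-covered = begin
    count covered   ≡⟨ C.size≡count ⟨
    C.size          ≤⟨ injective⇒≤ position-injective ⟩
    m + m           ≡⟨ cong (m +_) (+-identityʳ m) ⟨
    2 * m           ∎
    where
    open ≤-Reasoning
    module C = Enumeration (enumerate covered)
    position : Fin C.size → Fin (m + m)
    position i = join⊎ m m (side (covered⇒Covered (C.element-∈ i)))
    position-injective : Injective _≡_ _≡_ position
    position-injective {i} {j} e = C.element-injective (side-injective cᵢ cⱼ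
      (trans (sym (splitAt-join m m (side cᵢ))) (trans (cong (splitAt m) e) (splitAt-join m m (side cⱼ)))))
      where
      cᵢ : Covered M (C.element i)
      cᵢ = covered⇒Covered (C.element-∈ i)
      cⱼ : Covered M (C.element j)
      cⱼ = covered⇒Covered (C.element-∈ j)

Reach : (G : Graph) → Fin (n G) → Fin (n G) → Set
Reach G = WalkIn G (λ _ → Fin (n G))

HalfModel : Graph → Set
HalfModel G = ∃ λ t → ⌈ n G /2⌉ ≤ t × HasCliqueMinor₂ G t

module Disconnected (G : Graph) (noTriple : NoIndependentTriple G) {u v}
  (reach? : Decidable (Reach G u)) (unreachable : ¬ Reach G u v) where

  reached : Fin (n G) → Bool
  reached x = does (reach? x)

  reached-clique : ∀ x y → reached x ≡ true → reached y ≡ true → x ≢ y → _~_ G x y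
  reached-clique x y rx ry x≢y with reach? x | reach? y
  ... | yes ux | yes uy = decidable-stable (~-dec G x y) λ x≁y → noTriple (independentTriple G
        (x≢y , x≁y)
        ((λ { refl → unreachable ux }) , λ x~v → unreachable (WalkIn-snoc G ux x~v v))
        ((λ { refl → unreachable uy }) , λ y~v → unreachable (WalkIn-snoc G uy y~v v)))

  unreached-clique : ∀ x y → not (reached x) ≡ true → not (reached y) ≡ true → x ≢ y → _~_ G x y
  unreached-clique x y rx ry x≢y with reach? x | reach? y
  ... | no ¬ux | no ¬uy = decidable-stable (~-dec G x y) λ x≁y → noTriple (independentTriple G
        ((λ { refl → ¬ux (here u) }) , λ u~x → ¬ux (step u u~x (here x)))
        ((λ { refl → ¬uy (here u) }) , λ u~y → ¬uy (step u u~y (here y)))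
        (x≢y , x≁y))

  halfModel : HalfModel G
  halfModel with ⌈/2⌉≤-part (count-complement reached)
  ... | inj₁ half≤ = count reached , half≤ , cliqueModel G reached reached-clique
  ... | inj₂ half≤ = count (not ∘ reached) , half≤ , cliqueModel G (not ∘ reached) unreached-clique

-- A non-empty connected dominating matching is a model of K_m with branch sets of size two,
-- touching every branch set of a model in the subgraph induced on the uncovered vertices.
module DominatingMatching (G : Graph) (M : Matching G) (someEdge : NonEmptyMatching M)
  (connected : ConnectedMatching M) (dominating : DominatingMatching M) where

  open MatchingModel G M connected
  open Matching M using (m; a)
  module Uncovered = Enumeration (enumerate (not ∘ covered))

  uncovered-graph : Graph
  uncovered-graph = induced G Uncovered.element

  fewer : Uncovered.size < n G
  fewer = Uncovered.size< {a (fromℕ< someEdge)} (cong not (dec-true (endpoint? _) (_ , inj₁ refl)))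

  uncovered : ∀ i → ¬ Covered M (Uncovered.element i)
  uncovered i c with endpoint? (Uncovered.element i) | Uncovered.element-∈ i
  ... | yes _ | ()
  ... | no  u | _ = u c

  extend : HalfModel uncovered-graph → HalfModel G
  extend (t , half≤t , model′) =
    t + m , ⌈/2⌉≤ size , C.combined , C.combined-small (proj₂ lifted) (proj₂ model)
    where
    module L = Lift G Uncovered.element-injective
    lifted : HasCliqueMinor₂ G t
    lifted = L.lift₂ model′
    β′ : Fin Uncovered.size → Maybe (Fin t)
    β′ = β (proj₁ model′)
    disjoint : ∀ x {i} → L.pullback β′ x ≡ just i → edgeAt x ≡ nothing
    disjoint x βx with L.pullback-just β′ x βx
    ... | (j , refl , _) = edgeAt-uncovered (not≡true⇒≡false (Uncovered.element-∈ j))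
    touching : ∀ i j → ∃ λ u → ∃ λ v → L.pullback β′ u ≡ just i × edgeAt v ≡ just j × _~_ G u v
    touching i j with nonempty (proj₁ lifted) i
    ... | (u , βu) with L.pullback-just β′ u βu
    ...   | (k , refl , _) = let (x , ex , u~x) = dominating _ (uncovered k) j in
                             _ , x , βu , edgeAt-endpoint ex , u~x
    module C = Combine G (proj₁ lifted) (proj₁ model) disjoint touching
    open ≤-Reasoning
    uncovered≤2t : count (not ∘ covered) ≤ 2 * t
    uncovered≤2t = begin
      count (not ∘ covered)      ≡⟨ Uncovered.size≡count ⟨
      Uncovered.size             ≤⟨ ≤2*⌈/2⌉ Uncovered.size ⟩
      2 * ⌈ Uncovered.size /2⌉   ≤⟨ *-monoʳ-≤ 2 half≤t ⟩
      2 * t                      ∎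
    size : n G ≤ 2 * (t + m)
    size = begin
      n G                                   ≡⟨ count-complement covered ⟨
      count covered + count (not ∘ covered) ≤⟨ +-mono-≤ count-covered uncovered≤2t ⟩
      2 * m + 2 * t                         ≡⟨ +-comm (2 * m) (2 * t) ⟩
      2 * t + 2 * m                         ≡⟨ *-distribˡ-+ 2 t m ⟨
      2 * (t + m)                           ∎

ConnectedDominatingMatchings : Set₁
ConnectedDominatingMatchings = ∀ G → Connected G → IsAlpha G 2 → HasNonEmptyConnDomMatching G

half-model : ConnectedDominatingMatchings → ∀ G → NoIndependentTriple G → DoubleNegation (HalfModel G)
half-model cdm G = <-rec (λ k → ∀ G → n G ≡ k → NoIndependentTriple G → DoubleNegation (HalfModel G))
                         byOrder (n G) G refl
  where
  byOrder : ∀ k → (∀ {j} → j < k → ∀ G → n G ≡ j → NoIndependentTriple G → DoubleNegation (HalfModel G)) →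
            ∀ G → n G ≡ k → NoIndependentTriple G → DoubleNegation (HalfModel G)
  byOrder _ smaller G refl noTriple = do
    reach? ← ¬¬-∀-Fin λ u → ¬¬-decidable (Reach G u)
    case all? (λ u → all? (reach? u)) of λ where
      (no disconnected) →
        let (u , notAll) = ¬∀⟶∃¬ _ _ (λ u → all? (reach? u)) disconnected
            (v , noWalk) = ¬∀⟶∃¬ _ _ (reach? u) notAll
        in return (Disconnected.halfModel G noTriple (reach? u) noWalk)
      (yes connected) → case nonEdgeOrComplete G of λ where
        (inj₂ complete) → return (n G , ⌈n/2⌉≤n (n G) , completeModel G complete)
        (inj₁ (x , y , xy)) →
          let (M , someEdge , connectedM , dominating) = cdm G connected (α≡2 G noTriple xy)
              open DominatingMatching G M someEdge connectedM dominating
          in extend <$> smaller fewer uncovered-graph refl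
                          (noIndependentTriple-induced G Uncovered.element-injective noTriple)

module HC  = Counterexamples minors
module SHC = Counterexamples smallMinors

below-half : ∀ {h c n} → h < c → 2 * c ≤ n + 1 → 2 * h < n
below-half {h} {c} {n} h<c 2c≤n+1 = s≤s⁻¹ (begin
  suc (suc (2 * h))   ≡⟨ *-suc 2 h ⟨
  2 * suc h           ≤⟨ *-monoʳ-≤ 2 h<c ⟩
  2 * c               ≤⟨ 2c≤n+1 ⟩
  n + 1               ≡⟨ +-comm n 1 ⟩
  suc n               ∎)
  where open ≤-Reasoning

had<half⇒had<χ : ∀ G → IsAlpha G 2 → had<half G → had<χ G
had<half⇒had<χ G α₂ had<half h c isHad isChi =
  *-cancelˡ-< 2 h c (<-≤-trans (had<half h isHad) (χ-lower G (α≡2⇒noIndependentTriple G α₂) (proj₁ isChi)))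

minimal⇒had<half : ∀ G → Minimal CounterHC G → had<half G
minimal⇒had<half G minimal h isHad = decidable-stable (2 * h <? n G) do
  (c , isChi) ← ¬¬-χ G
  let (h<c , bound) = HC.minimal-counterexample-bound G minimal isHad isChi
  return (below-half h<c bound)

HC⇔HalfHC : HC-α2 ⇔ HalfHC-α2
HC⇔HalfHC = mk⇔ toHalf fromHalf
  where
  toHalf : HC-α2 → HalfHC-α2
  toHalf hc G α₂ h isHad = decidable-stable (n G ≤? 2 * h) do
    (c , isChi) ← ¬¬-χ G
    return (≤-trans (χ-lower G (α≡2⇒noIndependentTriple G α₂) (proj₁ isChi))
                    (*-monoʳ-≤ 2 (hc G α₂ h c isHad isChi)))
  fromHalf : HalfHC-α2 → HC-α2
  fromHalf = HC.conjecture-from-half (λ G h → n G ≤ 2 * h) λ G n≤2h h<c bound → <⇒≱ (below-half h<c bound) n≤2h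

had₂<ceilHalf⇒had₂<χ : ∀ G → IsAlpha G 2 → had₂<ceilHalf G → had₂<χ G
had₂<ceilHalf⇒had₂<χ G α₂ had₂<half h c isHad₂ isChi =
  <-≤-trans (had₂<half h isHad₂) (⌈/2⌉≤ (χ-lower G (α≡2⇒noIndependentTriple G α₂) (proj₁ isChi)))

minimal⇒had₂<ceilHalf : ∀ G → Minimal CounterSHC G → had₂<ceilHalf G
minimal⇒had₂<ceilHalf G minimal h isHad₂ = decidable-stable (h <? ⌈ n G /2⌉) do
  (c , isChi) ← ¬¬-χ G
  let (h<c , bound) = SHC.minimal-counterexample-bound G minimal isHad₂ isChi
  return (<-≤-trans h<c (≤⌈/2⌉ bound))

SHC-from-half : HalfSHC-α2 → SHC-α2
SHC-from-half = SHC.conjecture-from-half (λ G h → ⌈ n G /2⌉ ≤ h)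
  λ G half≤h h<c bound → <⇒≱ h<c (≤-trans (≤⌈/2⌉ bound) half≤h)

SHC⇔HalfSHC : SHC-α2 ⇔ HalfSHC-α2
SHC⇔HalfSHC = mk⇔ toHalf SHC-from-half
  where
  toHalf : SHC-α2 → HalfSHC-α2
  toHalf shc G α₂ h isHad₂ = decidable-stable (⌈ n G /2⌉ ≤? h) do
    (c , isChi) ← ¬¬-χ G
    return (≤-trans (⌈/2⌉≤ (χ-lower G (α≡2⇒noIndependentTriple G α₂) (proj₁ isChi)))
                    (shc G α₂ h c isHad₂ isChi))

connectedDominatingMatchings⇒SHC : ConnectedDominatingMatchings → SHC-α2
connectedDominatingMatchings⇒SHC cdm = SHC-from-half λ G α₂ h isHad₂ →
  decidable-stable (⌈ n G /2⌉ ≤? h) do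
    (t , half≤t , model) ← half-model cdm G (α≡2⇒noIndependentTriple G α₂)
    return (≤-trans half≤t (proj₂ isHad₂ t model))

SHC⇒HC : SHC-α2 → HC-α2
SHC⇒HC shc G α₂ h c isHad isChi = decidable-stable (c ≤? h) do
  (h₂ , isHad₂) ← SHC.¬¬-had G
  return (≤-trans (shc G α₂ h₂ c isHad₂ isChi) (proj₂ isHad h₂ (proj₁ (proj₁ isHad₂))))

theorem2p10 :
    -- (i)
    ((∀ G → IsAlpha G 2 → had<half G → had<χ G)
      × (∀ G → Minimal CounterHC G → had<half G)
      × (HC-α2 ⇔ HalfHC-α2))
    -- (ii)
    × ((∀ G → IsAlpha G 2 → had₂<ceilHalf G → had₂<χ G)
      × (∀ G → Minimal CounterSHC G → had₂<ceilHalf G)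
      × (SHC-α2 ⇔ HalfSHC-α2))
    -- (iii)
    × (((∀ G → Connected G → IsAlpha G 2 → HasNonEmptyConnDomMatching G) → SHC-α2)
      × (SHC-α2 → HC-α2))
theorem2p10 =
  (had<half⇒had<χ , minimal⇒had<half , HC⇔HalfHC) ,
  (had₂<ceilHalf⇒had₂<χ , minimal⇒had₂<ceilHalf , SHC⇔HalfSHC) ,
  (connectedDominatingMatchings⇒SHC , SHC⇒HC)
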